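{- Let $G$ be a finite bipartite graph with color classes $A$ and $B$, $b:V(G)\to\mathbb{Z}_{\ge0}$, and $M$ a maximum $b$-matching of $G$. Let $U_A$ be the set of $M$-loose vertices in $A$. Let $S_A$ be the set of vertices $x\in A$ such that there is an $M$-wedge path from $x$ to some vertex of $U_A$, and let $T_A$ be the set of vertices $y\in B$ such that there is an $M$-exposed path between $y$ and some vertex of $U_A$. Then (i) $S_A\cup(B\setminus T_A)$ is a $b$-verifying set, and (ii) $S_A=\mathcal{D}\cap A$. Moreover, $S_A\cup T_A$ is the union of the vertex sets of all inconsistent flexible components hooked up by $A$.
   Context: $\delta_H(v)$ is the set of edges of a graph $H$ at $v$. A $b$-matching is $M\subseteq E(G)$ with at most $b(v)$ edges of $M$ at each $v$; maximum = largest cardinality; $v$ is $M$-loose if fewer than $b(v)$ edges of $M$ are incident with it. Paths are subgraphs. A path $P$ with ends $x,y$ is $M$-wedge from $x$ to $y$ if $|\delta_P(v)\cap M|=1$ for each $v\in V(P)\setminus\{y\}$ and $\delta_P(y)\cap M=\emptyset$; $M$-exposed between $x$ and $y$ if $|\delta_P(v)\setminus M|=1$ for every $v\in V(P)$. An edge is allowed if in some maximum $b$-matching, forbidden otherwise; an allowed edge is inevitable if in every maximum $b$-matching, flexible otherwise. Flexible components: induced subgraphs $G[V(K)]$, $K$ a connected component of $(V(G),\{\text{flexible edges}\})$. $\mathcal{D}$: vertices $M'$-loose for some maximum $b$-matching $M'$. A flexible component $C$ is loose if it meets $\mathcal{D}$; $v$ is inactive if $b(v)=0$ (then $G[\{v\}]$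 is an inactive flexible component). $C$ is inconsistent hooked up by $A$ if $C$ is loose with $V(C)\cap\mathcal{D}\cap A\ne\emptyset$, or $C$ is inactive and its vertex has a neighbor in $\mathcal{D}\cap A$. $E[X]$: edges with both ends in $X$; $b(X)=\sum_{v\in X}b(v)$; $Z$ is $b$-verifying if $b(V(G)\setminus Z)+|E[Z]|$ equals the size of a maximum $b$-matching. -}

module Defs where

open import Data.Nat using (ℕ; _≤_; _<_; _+_)
open import Data.Fin using (Fin; zero; suc; inject₁; fromℕ)
open import Data.Fin.Properties using (_≟_; any?)
open import Data.Fin.Subset using (Subset; _∈_; _∉_; _∩_; ∣_∣; ∁)
open import Data.Vec using (tabulate; lookup)
open import Data.Bool using (Bool; true; false; _∧_; _∨_; if_then_else_)
open import Data.List using (map; allFin)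
open import Data.Nat.ListAction using (sum)
open import Data.Product using (_×_; ∃; Σ)
open import Data.Sum using (_⊎_)
open import Function.Definitions using (Injective)
open import Relation.Binary.PropositionalEquality using (_≡_; _≢_)
open import Relation.Binary.Construct.Closure.ReflexiveTransitive using (Star)
open import Relation.Nullary using (¬_)
open import Relation.Nullary.Decidable using (⌊_⌋)

record Graph : Set where
  field
    nV nE : ℕ
    end₁ end₂ : Fin nE → Fin nV

open Graph public

module _ (G : Graph) where

  Joins : Fin (nE G) → Fin (nV G) → Fin (nV G) → Set
  Joins e u w = (end₁ G e ≡ u × end₂ G e ≡ w) ⊎ (end₁ G e ≡ w × end₂ G e ≡ u)

  Adj : Fin (nV G) → Fin (nV G) → Set
  Adj u w = ∃ λ e → Joins e u w

  δ : Fin (nV G) → Subset (nE G)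
  δ v = tabulate λ e → ⌊ end₁ G e ≟ v ⌋ ∨ ⌊ end₂ G e ≟ v ⌋

  deg : Subset (nE G) → Fin (nV G) → ℕ
  deg M v = ∣ M ∩ δ v ∣

  IsBMatching : (Fin (nV G) → ℕ) → Subset (nE G) → Set
  IsBMatching b M = ∀ v → deg M v ≤ b v

  IsMaxBMatching : (Fin (nV G) → ℕ) → Subset (nE G) → Set
  IsMaxBMatching b M =
    IsBMatching b M × (∀ M' → IsBMatching b M' → ∣ M' ∣ ≤ ∣ M ∣)

  Loose : (Fin (nV G) → ℕ) → Subset (nE G) → Fin (nV G) → Set
  Loose b M v = deg M v < b v

  record Path : Set where
    field
      len : ℕ
      vert : Fin (ℕ.suc len) → Fin (nV G)
      vert-inj : Injective _≡_ _≡_ vert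
      edge : Fin len → Fin (nE G)
      edge-ok : ∀ i → Joins (edge i) (vert (inject₁ i)) (vert (suc i))

  open Path public

  start finish : Path → Fin (nV G)
  start P = vert P zero
  finish P = vert P (fromℕ (len P))

  OnPath : Path → Fin (nV G) → Set
  OnPath P v = ∃ λ i → vert P i ≡ v

  pathEdges : Path → Subset (nE G)
  pathEdges P = tabulate λ e → ⌊ any? (λ i → edge P i ≟ e) ⌋

  δP : Path → Fin (nV G) → Subset (nE G)
  δP P v = pathEdges P ∩ δ v

  Wedge : Subset (nE G) → Path → Fin (nV G) → Fin (nV G) → Set
  Wedge M P x y =
    start P ≡ x × finish P ≡ y
    × (∀ v → OnPath P v → v ≢ y → ∣ δP P v ∩ M ∣ ≡ 1)
    × ∣ δP P y ∩ M ∣ ≡ 0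

  Exposed : Subset (nE G) → Path → Fin (nV G) → Fin (nV G) → Set
  Exposed M P x y =
    ((start P ≡ x × finish P ≡ y) ⊎ (start P ≡ y × finish P ≡ x))
    × (∀ v → OnPath P v → ∣ δP P v ∩ ∁ M ∣ ≡ 1)

  module _ (b : Fin (nV G) → ℕ) where

    D : Fin (nV G) → Set
    D v = ∃ λ M' → IsMaxBMatching b M' × Loose b M' v

    Allowed : Fin (nE G) → Set
    Allowed e = ∃ λ M' → IsMaxBMatching b M' × e ∈ M'

    Flexible : Fin (nE G) → Set
    Flexible e = Allowed e × ∃ λ M' → IsMaxBMatching b M' × e ∉ M'

    FlexAdj : Fin (nV G) → Fin (nV G) → Set
    FlexAdj u w = ∃ λ e → Flexible e × Joins e u w

    FlexConn : Fin (nV G) → Fin (nV G) → Set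
    FlexConn = Star FlexAdj

    bsum : Subset (nV G) → ℕ
    bsum X = sum (map (λ v → if lookup X v then b v else 0) (allFin (nV G)))

    EIn : Subset (nV G) → Subset (nE G)
    EIn Z = tabulate λ e → lookup Z (end₁ G e) ∧ lookup Z (end₂ G e)

    BVerifying : Subset (nV G) → Set
    BVerifying Z = ∃ λ M' → IsMaxBMatching b M' × bsum (∁ Z) + ∣ EIn Z ∣ ≡ ∣ M' ∣

    -- the flexible component C_v containing v is inconsistent hooked up by A
    -- (A = vertices with inA v ≡ true). C_v is inactive iff b v ≡ 0 (then C_v = {v}).
    InconsistentHookedUp : (Fin (nV G) → Bool) → Fin (nV G) → Set
    InconsistentHookedUp inA v =
      ((∃ λ w → FlexConn v w × D w)
        × (∃ λ w → FlexConn v w × D w × inA w ≡ true))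
      ⊎ (b v ≡ 0 × ∃ λ w → Adj v w × D w × inA w ≡ true)

    module _ (inA : Fin (nV G) → Bool) (M : Subset (nE G)) where

      UA : Fin (nV G) → Set
      UA v = inA v ≡ true × Loose b M v

      SA : Fin (nV G) → Set
      SA x = inA x ≡ true × ∃ λ P → ∃ λ u → UA u × Wedge M P x u

      TA : Fin (nV G) → Set
      TA y = inA y ≡ false × ∃ λ P → ∃ λ u → UA u × Exposed M P y u

module Submission where

-- In these terms a wedge starts
-- with an M-edge and continues as an exposed path, and an exposed path
-- starts with a non-M edge and continues as a wedge.  Switching M along a
-- wedge ending at a loose vertex moves the looseness to its first vertex
-- (so S_A ⊆ 𝒟), and switching along an exposed path between loose vertices
-- would augment M (so T_A is saturated).  Prepending edges shows that S_A
-- and T_A are closed under non-M edges S_A → B and M-edges T_A → A.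
-- A weak-duality identity, |X| + |X ∩ E[∁Z]| = Σ_{v∉Z} deg_X v + |X ∩ E[Z]|,
-- then shows that M is tight for Z = S_A ∪ (B ∖ T_A), which is part (i);
-- every other maximum b-matching is tight for Z too, which gives (ii) and
-- shows that flexible edges cannot leave S_A ∪ T_A, the main step of (iii).

open import Defs
open import Data.Nat using (ℕ; zero; suc; _+_; _≤_; _<_; z≤n; s≤s)
import Data.Nat.Properties as ℕₚ
open ℕₚ using (suc-injective; +-comm; +-suc; +-identityʳ; +-cancelˡ-≡; +-cancelʳ-≡; +-mono-≤; +-monoʳ-≤;
               +-cancelˡ-≤; +-cancelʳ-≤; ≤-antisym; ≤-trans; ≤-refl; ≤-reflexive; m≤m+n; m≤n+m; <-irrefl;
               n≤0⇒n≡0; ≮⇒≥; n≢0⇒n>0; _<?_; anyUpTo?; +-0-commutativeMonoid)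
open import Data.Nat.Tactic.RingSolver using (solve-∀)
open import Data.Fin using (Fin; zero; suc; toℕ; inject₁; fromℕ; opposite)
import Data.Fin.Properties as Finₚ
open Finₚ using (_≟_; any?; all?; toℕ-inject₁; toℕ-injective)
open import Data.Fin.Subset using (Subset; _∈_; _∩_; ∣_∣; ∁)
open import Data.Vec using (Vec; []; _∷_; lookup; tabulate)
import Data.Vec.Properties as Vecₚ
open Vecₚ using (lookup-zipWith; lookup-map; lookup∘tabulate; []=⇒lookup; lookup⇒[]=)
open import Data.Bool using (Bool; true; false; _∧_; _∨_; not; _xor_; if_then_else_)
import Data.Bool.Properties as Boolₚ
open Boolₚ using (¬-not; ∨-comm; ∧-assoc; ∧-zeroʳ; ∧-identityʳ)
import Data.List as List
import Data.Nat.ListAction as ListAction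
open import Data.Product using (_×_; _,_; ∃; Σ; proj₁; proj₂)
open import Data.Sum using (_⊎_; inj₁; inj₂)
open import Data.Empty using (⊥; ⊥-elim)
open import Function using (_∘_)
open import Function.Bundles using (_⇔_; mk⇔; Equivalence)
open import Function.Definitions using (Injective)
open import Relation.Nullary using (¬_; Dec; yes; no)
open import Relation.Nullary.Decidable using (⌊_⌋; map′; _×-dec_; _⊎-dec_; _→-dec_; ¬?)
open import Relation.Binary.PropositionalEquality
open import Relation.Binary.Construct.Closure.ReflexiveTransitive using (ε; _◅_; _◅◅_)
import Relation.Binary.Construct.Closure.ReflexiveTransitive as Star
open import Algebra.Properties.CommutativeMonoid.Sum +-0-commutativeMonoid
  using (sum; sum-cong-≗; ∑-distrib-+; ∑-comm; sum-replicate-zero)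

𝟙 : Bool → ℕ
𝟙 true = 1
𝟙 false = 0

𝟙≡1 : ∀ {a} → 𝟙 a ≡ 1 → a ≡ true
𝟙≡1 {true} _ = refl

true≢false : true ≢ false
true≢false ()

sum-zero : ∀ {n} {f : Fin n → ℕ} → (∀ i → f i ≡ 0) → sum f ≡ 0
sum-zero {n} h = trans (sum-cong-≗ h) (sum-replicate-zero n)

sum-mono-≤ : ∀ {n} {f g : Fin n → ℕ} → (∀ i → f i ≤ g i) → sum f ≤ sum g
sum-mono-≤ {zero} h = z≤n
sum-mono-≤ {suc n} h = +-mono-≤ (h zero) (sum-mono-≤ (h ∘ suc))

sum-tight : ∀ {n} {f g : Fin n → ℕ} → (∀ i → f i ≤ g i) → sum f ≡ sum g → ∀ i → f i ≡ g i
sum-tight {suc n} {f} {g} h eq i = go i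
  where
  head≡ : f zero ≡ g zero
  head≡ = ≤-antisym (h zero) (+-cancelʳ-≤ _ _ _ (≤-trans (≤-reflexive (sym eq))
            (+-monoʳ-≤ (f zero) (sum-mono-≤ (h ∘ suc)))))
  go : ∀ i → f i ≡ g i
  go zero = head≡
  go (suc i) = sum-tight (h ∘ suc) (+-cancelˡ-≡ (f zero) _ _ (trans eq (cong (_+ _) (sym head≡)))) i

+-≤-tight : ∀ {a c d e} → a ≤ c → d ≤ e → a + d ≡ c + e → a ≡ c × d ≡ e
+-≤-tight {a} {c} {d} {e} a≤c d≤e eq = a≡c , +-cancelˡ-≡ a _ _ (trans eq (cong (_+ e) (sym a≡c)))
  where
  a≡c : a ≡ c
  a≡c = ≤-antisym a≤c (+-cancelʳ-≤ e c a (≤-trans (≤-reflexive (sym eq)) (+-monoʳ-≤ a d≤e)))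

sum-single : ∀ {n} {f : Fin n → ℕ} (a : Fin n) → (∀ i → i ≢ a → f i ≡ 0) → sum f ≡ f a
sum-single {suc n} {f} zero h = trans (cong (f zero +_) (sum-zero (λ i → h (suc i) λ ()))) (+-identityʳ _)
sum-single {suc n} {f} (suc a) h =
  trans (cong (_+ sum (f ∘ suc)) (h zero λ ()))
        (sum-single a (λ i i≢a → h (suc i) (i≢a ∘ Finₚ.suc-injective)))

term≤sum : ∀ {n} (f : Fin n → ℕ) a → f a ≤ sum f
term≤sum f zero = m≤m+n _ _
term≤sum f (suc a) = ≤-trans (term≤sum (f ∘ suc) a) (m≤n+m _ _)

sum-pos : ∀ {n} {f : Fin n → ℕ} → 0 < sum f → ∃ λ i → 0 < f i
sum-pos {suc n} {f} p with f zero in eq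
... | suc k = zero , subst (0 <_) (sym eq) (s≤s z≤n)
... | zero = let (i , q) = sum-pos {n} p in suc i , q

sum-allFin : ∀ n (f : Fin n → ℕ) → ListAction.sum (List.map f (List.allFin n)) ≡ sum f
sum-allFin n f = go n (λ i → i)
  where
  go : ∀ m (g : Fin m → Fin n) → ListAction.sum (List.map f (List.tabulate g)) ≡ sum (f ∘ g)
  go zero g = refl
  go (suc m) g = cong (f (g zero) +_) (go m (g ∘ suc))

card : ∀ {n} (X : Subset n) → ∣ X ∣ ≡ sum (𝟙 ∘ lookup X)
card [] = refl
card (true ∷ X) = cong suc (card X)
card (false ∷ X) = card X

lookup-∩ : ∀ {n} (X Y : Subset n) i → lookup (X ∩ Y) i ≡ (lookup X i ∧ lookup Y i)
lookup-∩ X Y i = lookup-zipWith _∧_ i X Y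

lookup-∁ : ∀ {n} (X : Subset n) i → lookup (∁ X) i ≡ not (lookup X i)
lookup-∁ X i = lookup-map i not X

∈⇒lookup : ∀ {n} {X : Subset n} {i} → i ∈ X → lookup X i ≡ true
∈⇒lookup = []=⇒lookup

lookup⇒∈ : ∀ {n} {X : Subset n} {i} → lookup X i ≡ true → i ∈ X
lookup⇒∈ {X = X} {i} = lookup⇒[]= i X

member-card : ∀ {n} (X : Subset n) {i} → lookup X i ≡ true → 1 ≤ ∣ X ∣
member-card X {i} Xi = ≤-trans (≤-reflexive (cong 𝟙 (sym Xi)))
  (≤-trans (term≤sum (𝟙 ∘ lookup X) i) (≤-reflexive (sym (card X))))

card-+-pointwise : ∀ {n} (A B C D : Subset n) →
  (∀ i → 𝟙 (lookup A i) + 𝟙 (lookup B i) ≡ 𝟙 (lookup C i) + 𝟙 (lookup D i)) →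
  ∣ A ∣ + ∣ B ∣ ≡ ∣ C ∣ + ∣ D ∣
card-+-pointwise A B C D h = begin
  ∣ A ∣ + ∣ B ∣                                   ≡⟨ cong₂ _+_ (card A) (card B) ⟩
  sum (𝟙 ∘ lookup A) + sum (𝟙 ∘ lookup B)         ≡⟨ ∑-distrib-+ (𝟙 ∘ lookup A) (𝟙 ∘ lookup B) ⟨
  sum (λ i → 𝟙 (lookup A i) + 𝟙 (lookup B i))     ≡⟨ sum-cong-≗ h ⟩
  sum (λ i → 𝟙 (lookup C i) + 𝟙 (lookup D i))     ≡⟨ ∑-distrib-+ (𝟙 ∘ lookup C) (𝟙 ∘ lookup D) ⟩
  sum (𝟙 ∘ lookup C) + sum (𝟙 ∘ lookup D)         ≡⟨ cong₂ _+_ (card C) (card D) ⟨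
  ∣ C ∣ + ∣ D ∣                                   ∎
  where open ≡-Reasoning

⌊⌋-true : ∀ {a} {P : Set a} (d : Dec P) → P → ⌊ d ⌋ ≡ true
⌊⌋-true (yes _) _ = refl
⌊⌋-true (no ¬p) p = ⊥-elim (¬p p)

⌊⌋-false : ∀ {a} {P : Set a} (d : Dec P) → ¬ P → ⌊ d ⌋ ≡ false
⌊⌋-false (yes p) ¬p = ⊥-elim (¬p p)
⌊⌋-false (no _) _ = refl

⌊⌋-true⁻ : ∀ {a} {P : Set a} (d : Dec P) → ⌊ d ⌋ ≡ true → P
⌊⌋-true⁻ (yes p) _ = p

⌊⌋-cong : ∀ {a} {P R : Set a} (p? : Dec P) (r? : Dec R) → (P → R) → (R → P) → ⌊ p? ⌋ ≡ ⌊ r? ⌋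
⌊⌋-cong (yes p) (yes r) f g = refl
⌊⌋-cong (yes p) (no ¬r) f g = ⊥-elim (¬r (f p))
⌊⌋-cong (no ¬p) (yes r) f g = ⊥-elim (¬p (g r))
⌊⌋-cong (no ¬p) (no ¬r) f g = refl

module Incidence (G : Graph) where

  V E : Set
  V = Fin (nV G)
  E = Fin (nE G)

  _==_ : V → V → Bool
  a == v = ⌊ a ≟ v ⌋

  ==-refl : ∀ a → (a == a) ≡ true
  ==-refl a = ⌊⌋-true (a ≟ a) refl

  ==-false : ∀ {a v} → a ≢ v → (a == v) ≡ false
  ==-false {a} {v} = ⌊⌋-false (a ≟ v)

  incident : V → E → Bool
  incident v e = (end₁ G e == v) ∨ (end₂ G e == v)

  lookup-δ : ∀ v e → lookup (δ G v) e ≡ incident v e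
  lookup-δ v e = lookup∘tabulate _ e

  incident-joins : ∀ {e a w} v → Joins G e a w → incident v e ≡ ((a == v) ∨ (w == v))
  incident-joins v (inj₁ (refl , refl)) = refl
  incident-joins {e} v (inj₂ (refl , refl)) = ∨-comm (end₁ G e == v) _

  joins-sym : ∀ {e a w} → Joins G e a w → Joins G e w a
  joins-sym (inj₁ x) = inj₂ x
  joins-sym (inj₂ x) = inj₁ x

  joins-unique : ∀ {e a w c d} → Joins G e a w → Joins G e c d → (a ≡ c × w ≡ d) ⊎ (a ≡ d × w ≡ c)
  joins-unique (inj₁ (refl , refl)) (inj₁ (refl , refl)) = inj₁ (refl , refl)
  joins-unique (inj₁ (refl , refl)) (inj₂ (refl , refl)) = inj₂ (refl , refl)
  joins-unique (inj₂ (refl , refl)) (inj₁ (refl , refl)) = inj₂ (refl , refl)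
  joins-unique (inj₂ (refl , refl)) (inj₂ (refl , refl)) = inj₁ (refl , refl)

  deg-sum : ∀ (X : Subset (nE G)) v → deg G X v ≡ sum (λ e → 𝟙 (lookup X e ∧ incident v e))
  deg-sum X v = trans (card (X ∩ δ G v))
    (sum-cong-≗ (λ e → cong 𝟙 (trans (lookup-∩ X (δ G v) e) (cong (lookup X e ∧_) (lookup-δ v e)))))

  member-deg : ∀ X {e v w} → lookup X e ≡ true → Joins G e v w → 1 ≤ deg G X v
  member-deg X {e} {v} {w} Xe j = member-card (X ∩ δ G v) (begin
    lookup (X ∩ δ G v) e              ≡⟨ lookup-∩ X (δ G v) e ⟩
    lookup X e ∧ lookup (δ G v) e     ≡⟨ cong₂ _∧_ Xe (trans (lookup-δ v e) (incident-joins v j)) ⟩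
    (v == v) ∨ (w == v)               ≡⟨ cong (_∨ (w == v)) (==-refl v) ⟩
    true ∎)
    where open ≡-Reasoning

  edge-at : ∀ X v → 0 < deg G X v → ∃ λ g → lookup X g ≡ true × incident v g ≡ true
  edge-at X v pos with sum-pos (subst (0 <_) (deg-sum X v) pos)
  ... | g , p with lookup X g in Xg | incident v g in vg
  ... | true | true = g , Xg , vg
  ... | true | false = ⊥-elim (<-irrefl refl p)
  ... | false | _ = ⊥-elim (<-irrefl refl p)

-- Paths of a fixed length L, with the same data as Defs.Path but indexed
-- by L so that induction along the path is structural recursion.
module Paths (G : Graph) where

  open Incidence G

  record IPath (L : ℕ) : Set where
    field
      vt : Fin (suc L) → V
      vt-inj : Injective _≡_ _≡_ vt
      ed : Fin L → E
      ed-joins : ∀ i → Joins G (ed i) (vt (inject₁ i)) (vt (suc i))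

  open IPath public

  asPath : ∀ {L} → IPath L → Path G
  asPath Q = record { len = _ ; vert = vt Q ; vert-inj = vt-inj Q ; edge = ed Q ; edge-ok = ed-joins Q }

  ofPath : (P : Path G) → IPath (len P)
  ofPath P = record { vt = vert P ; vt-inj = vert-inj P ; ed = edge P ; ed-joins = edge-ok P }

  first last : ∀ {L} → IPath L → V
  first Q = vt Q zero
  last {L} Q = vt Q (fromℕ L)

  On : ∀ {L} → IPath L → V → Set
  On Q v = ∃ λ i → vt Q i ≡ v

  On? : ∀ {L} (Q : IPath L) v → Dec (On Q v)
  On? Q v = any? (λ i → vt Q i ≟ v)

  tail : ∀ {L} → IPath (suc L) → IPath L
  tail Q = record { vt = vt Q ∘ suc ; vt-inj = Finₚ.suc-injective ∘ vt-inj Q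
                  ; ed = ed Q ∘ suc ; ed-joins = ed-joins Q ∘ suc }

  on-tail : ∀ {L} (Q : IPath (suc L)) {v} → On (tail Q) v → On Q v
  on-tail Q (j , e) = suc j , e

  later≢first : ∀ {L} (Q : IPath (suc L)) (j : Fin (suc L)) → vt Q (suc j) ≢ first Q
  later≢first Q j eq with vt-inj Q eq
  ... | ()

  on-tail≢first : ∀ {L} (Q : IPath (suc L)) {v} → On (tail Q) v → v ≢ first Q
  on-tail≢first Q (j , refl) = later≢first Q j

  last≢first : ∀ {L} (Q : IPath (suc L)) → last Q ≢ first Q
  last≢first {L} Q = later≢first Q (fromℕ L)

  trivial : V → IPath 0
  trivial v = record { vt = λ _ → v ; vt-inj = λ { {zero} {zero} _ → refl } ; ed = λ () ; ed-joins = λ () }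

  cons : ∀ {L} (Q : IPath L) (y : V) (f : E) → ¬ On Q y → Joins G f y (first Q) → IPath (suc L)
  cons Q y f y∉Q j = record { vt = vt′ ; vt-inj = inj′ ; ed = ed′ ; ed-joins = joins′ }
    where
    vt′ : Fin (suc (suc _)) → V
    vt′ zero = y
    vt′ (suc i) = vt Q i
    inj′ : Injective _≡_ _≡_ vt′
    inj′ {zero} {zero} _ = refl
    inj′ {zero} {suc j} eq = ⊥-elim (y∉Q (j , sym eq))
    inj′ {suc i} {zero} eq = ⊥-elim (y∉Q (i , eq))
    inj′ {suc i} {suc j} eq = cong suc (vt-inj Q eq)
    ed′ : Fin (suc _) → E
    ed′ zero = f
    ed′ (suc i) = ed Q i
    joins′ : ∀ i → Joins G (ed′ i) (vt′ (inject₁ i)) (vt′ (suc i))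
    joins′ zero = j
    joins′ (suc i) = ed-joins Q i

  on-cons : ∀ {L} (Q : IPath L) y f y∉Q j {v} → On (cons Q y f y∉Q j) v → y ≡ v ⊎ On Q v
  on-cons Q y f y∉Q j (zero , e) = inj₁ e
  on-cons Q y f y∉Q j (suc i , e) = inj₂ (i , e)

  opposite-inject₁ : ∀ {L} (i : Fin L) → opposite (inject₁ i) ≡ suc (opposite i)
  opposite-inject₁ {suc L} zero = refl
  opposite-inject₁ {suc L} (suc i) = cong inject₁ (opposite-inject₁ i)

  reverse : ∀ {L} → IPath L → IPath L
  reverse Q = record
    { vt = vt Q ∘ opposite
    ; vt-inj = λ eq → trans (sym (Finₚ.opposite-involutive _))
                 (trans (cong opposite (vt-inj Q eq)) (Finₚ.opposite-involutive _))
    ; ed = ed Q ∘ opposite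
    ; ed-joins = λ i → subst (λ k → Joins G (ed Q (opposite i)) (vt Q k) (vt Q (inject₁ (opposite i))))
                      (sym (opposite-inject₁ i)) (joins-sym (ed-joins Q (opposite i))) }

  last-reverse : ∀ {L} (Q : IPath L) → last (reverse Q) ≡ first Q
  last-reverse {L} Q = cong (vt Q) (Finₚ.opposite-involutive {suc L} zero)

  on-reverse : ∀ {L} (Q : IPath L) {v} → On (reverse Q) v → On Q v
  on-reverse Q (i , e) = opposite i , e

  inject₁-injective : ∀ {n} {i j : Fin n} → inject₁ i ≡ inject₁ j → i ≡ j
  inject₁-injective {i = i} {j} eq =
    toℕ-injective (trans (sym (toℕ-inject₁ i)) (trans (cong toℕ eq) (toℕ-inject₁ j)))

  ed-injective : ∀ {L} (Q : IPath L) → Injective _≡_ _≡_ (ed Q)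
  ed-injective Q {i} {j} eq with joins-unique (ed-joins Q i) (subst (λ e → Joins G e _ _) (sym eq) (ed-joins Q j))
  ... | inj₁ (p , _) = inject₁-injective (vt-inj Q p)
  ... | inj₂ (p , q) = ⊥-elim (crossed (cong toℕ (vt-inj Q p)) (cong toℕ (vt-inj Q q)))
    where
    crossed : toℕ (inject₁ i) ≡ suc (toℕ j) → suc (toℕ i) ≡ toℕ (inject₁ j) → ⊥
    crossed a c rewrite toℕ-inject₁ i | toℕ-inject₁ j | a = n≢2+n (toℕ j) (sym c)
      where
      n≢2+n : ∀ n → n ≢ suc (suc n)
      n≢2+n zero ()
      n≢2+n (suc n) e = n≢2+n n (suc-injective e)

  count : ∀ {L} → IPath L → (E → Bool) → ℕ
  count Q Y = sum (λ i → 𝟙 (Y (ed Q i)))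

  count-cong : ∀ {L} (Q : IPath L) {Y Y′ : E → Bool} → (∀ e → Y e ≡ Y′ e) → count Q Y ≡ count Q Y′
  count-cong Q h = sum-cong-≗ (λ i → cong 𝟙 (h (ed Q i)))

  sum-image : ∀ {N L} (g : Fin L → Fin N) → Injective _≡_ _≡_ g → (Y : Fin N → Bool) →
    sum (λ e → 𝟙 (⌊ any? (λ i → g i ≟ e) ⌋ ∧ Y e)) ≡ sum (λ i → 𝟙 (Y (g i)))
  sum-image {N} {zero} g g-inj Y =
    sum-zero (λ e → cong (λ z → 𝟙 (z ∧ Y e)) (⌊⌋-false (any? (λ i → g i ≟ e)) (λ { (() , _) })))
  sum-image {N} {suc L} g g-inj Y = begin
    sum (λ e → 𝟙 (⌊ any? (λ i → g i ≟ e) ⌋ ∧ Y e))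
      ≡⟨ sum-cong-≗ split ⟩
    sum (λ e → 𝟙 (⌊ g zero ≟ e ⌋ ∧ Y e) + 𝟙 (⌊ any? (λ i → g (suc i) ≟ e) ⌋ ∧ Y e))
      ≡⟨ ∑-distrib-+ (λ e → 𝟙 (⌊ g zero ≟ e ⌋ ∧ Y e)) _ ⟩
    sum (λ e → 𝟙 (⌊ g zero ≟ e ⌋ ∧ Y e)) + sum (λ e → 𝟙 (⌊ any? (λ i → g (suc i) ≟ e) ⌋ ∧ Y e))
      ≡⟨ cong₂ _+_ head (sum-image (g ∘ suc) (Finₚ.suc-injective ∘ g-inj) Y) ⟩
    𝟙 (Y (g zero)) + sum (λ i → 𝟙 (Y (g (suc i)))) ∎
    where
    open ≡-Reasoning
    head : sum (λ e → 𝟙 (⌊ g zero ≟ e ⌋ ∧ Y e)) ≡ 𝟙 (Y (g zero))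
    head = trans (sum-single (g zero) (λ e e≢ → cong (λ z → 𝟙 (z ∧ Y e)) (⌊⌋-false (g zero ≟ e) (e≢ ∘ sym))))
                 (cong (λ z → 𝟙 (z ∧ Y (g zero))) (⌊⌋-true (g zero ≟ g zero) refl))
    split : ∀ e → 𝟙 (⌊ any? (λ i → g i ≟ e) ⌋ ∧ Y e)
                ≡ 𝟙 (⌊ g zero ≟ e ⌋ ∧ Y e) + 𝟙 (⌊ any? (λ i → g (suc i) ≟ e) ⌋ ∧ Y e)
    split e with g zero ≟ e | any? (λ i → g (suc i) ≟ e) | any? (λ i → g i ≟ e)
    ... | yes p | yes (j , q) | _ with () ← g-inj (trans p (sym q))
    ... | yes p | no _ | yes _ = sym (+-identityʳ _)
    ... | yes p | no _ | no n = ⊥-elim (n (zero , p))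
    ... | no _ | yes (j , q) | no n = ⊥-elim (n (suc j , q))
    ... | no _ | yes (j , q) | yes _ = refl
    ... | no _ | no _ | no _ = refl
    ... | no np | no _ | yes (zero , r) = ⊥-elim (np r)
    ... | no _ | no nq | yes (suc j , r) = ⊥-elim (nq (j , r))

  card-on-path : ∀ {L} (Q : IPath L) (S : Subset (nE G)) (Y : E → Bool) →
    (∀ e → lookup S e ≡ (lookup (pathEdges G (asPath Q)) e ∧ Y e)) → ∣ S ∣ ≡ count Q Y
  card-on-path Q S Y h = trans (card S)
    (trans (sum-cong-≗ (λ e → cong 𝟙 (trans (h e) (cong (_∧ Y e) (lookup∘tabulate _ e)))))
           (sum-image (ed Q) (ed-injective Q) Y))

  card-pathEdges : ∀ {L} (Q : IPath L) (X : Subset (nE G)) →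
    ∣ pathEdges G (asPath Q) ∩ X ∣ ≡ count Q (lookup X)
  card-pathEdges Q X = card-on-path Q (pathEdges G (asPath Q) ∩ X) (lookup X) (lookup-∩ (pathEdges G (asPath Q)) X)

  card-δP : ∀ {L} (Q : IPath L) v (X : Subset (nE G)) →
    ∣ δP G (asPath Q) v ∩ X ∣ ≡ count Q (λ e → incident v e ∧ lookup X e)
  card-δP Q v X = card-on-path Q (δP G (asPath Q) v ∩ X) (λ e → incident v e ∧ lookup X e) λ e →
    trans (lookup-∩ (δP G (asPath Q) v) X e)
      (trans (cong (_∧ lookup X e) (trans (lookup-∩ (pathEdges G (asPath Q)) (δ G v) e)
                                          (cong (_ ∧_) (lookup-δ v e))))
             (∧-assoc _ (incident v e) (lookup X e)))

  incident-off : ∀ {L} (Q : IPath L) v i → ¬ On Q v → incident v (ed Q i) ≡ false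
  incident-off Q v i v∉Q rewrite incident-joins v (ed-joins Q i)
    with vt Q (inject₁ i) ≟ v | vt Q (suc i) ≟ v
  ... | yes p | _ = ⊥-elim (v∉Q (_ , p))
  ... | no _ | yes p = ⊥-elim (v∉Q (_ , p))
  ... | no _ | no _ = refl

  count-off : ∀ {L} (Q : IPath L) v (Y : E → Bool) → ¬ On Q v → count Q (λ e → incident v e ∧ Y e) ≡ 0
  count-off Q v Y v∉Q = sum-zero (λ i → cong (λ z → 𝟙 (z ∧ Y (ed Q i))) (incident-off Q v i v∉Q))

  path-degree : ∀ {L} (Q : IPath L) v → On Q v →
    count Q (incident v) + 𝟙 (first Q == v) + 𝟙 (last Q == v) ≡ 2
  path-degree {zero} Q v (zero , refl) rewrite ==-refl (vt Q zero) = refl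
  path-degree {suc L} Q v (zero , refl)
    rewrite incident-joins (first Q) (ed-joins Q zero) | ==-refl (first Q)
          | sum-zero (λ i → cong 𝟙 (incident-off (tail Q) (first Q) i (λ o → on-tail≢first Q o refl)))
          | ==-false (last≢first Q) = refl
  path-degree {suc L} Q v (suc j , refl) = begin
    𝟙 (incident v (ed Q zero)) + count (tail Q) (incident v) + 𝟙 (first Q == v) + 𝟙 (last Q == v)
      ≡⟨ cong₂ (λ x y → 𝟙 x + count (tail Q) (incident v) + 𝟙 y + 𝟙 (last Q == v))
               (trans (incident-joins v (ed-joins Q zero)) (cong (_∨ (vt Q (suc zero) == v)) first≢v)) first≢v ⟩
    𝟙 (vt Q (suc zero) == v) + count (tail Q) (incident v) + 0 + 𝟙 (last Q == v)
      ≡⟨ cong (_+ 𝟙 (last Q == v)) (trans (+-identityʳ _) (+-comm (𝟙 (vt Q (suc zero) == v)) _)) ⟩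
    count (tail Q) (incident v) + 𝟙 (first (tail Q) == v) + 𝟙 (last (tail Q) == v)
      ≡⟨ path-degree (tail Q) v (j , refl) ⟩
    2 ∎
    where
    open ≡-Reasoning
    first≢v : (first Q == v) ≡ false
    first≢v = ==-false (later≢first Q j ∘ sym)

  count-split : ∀ {L} (Q : IPath L) v (Y : E → Bool) →
    count Q (λ e → incident v e ∧ Y e) + count Q (λ e → incident v e ∧ not (Y e)) ≡ count Q (incident v)
  count-split Q v Y = trans (sym (∑-distrib-+ (λ i → 𝟙 (incident v (ed Q i) ∧ Y (ed Q i))) _)) (sum-cong-≗ (λ i → split (incident v (ed Q i)) (Y (ed Q i))))
    where
    split : ∀ a c → 𝟙 (a ∧ c) + 𝟙 (a ∧ not c) ≡ 𝟙 a
    split true true = refl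
    split true false = refl
    split false c = refl

  pathEdges-reverse : ∀ {L} (Q : IPath L) → pathEdges G (asPath (reverse Q)) ≡ pathEdges G (asPath Q)
  pathEdges-reverse Q = Vecₚ.tabulate-cong λ e →
    ⌊⌋-cong (any? (λ i → ed Q (opposite i) ≟ e)) (any? (λ i → ed Q i ≟ e))
      (λ { (i , q) → opposite i , q })
      (λ { (i , q) → opposite i , trans (cong (ed Q) (Finₚ.opposite-involutive i)) q })

  count-reverse : ∀ {L} (Q : IPath L) v (X : Subset (nE G)) →
    count (reverse Q) (λ e → incident v e ∧ lookup X e) ≡ count Q (λ e → incident v e ∧ lookup X e)
  count-reverse Q v X = trans (sym (card-δP (reverse Q) v X))
    (trans (cong (λ p → ∣ (p ∩ δ G v) ∩ X ∣) (pathEdges-reverse Q)) (card-δP Q v X))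

module SymmetricDifference (G : Graph) where

  open Incidence G

  _⊕_ : Subset (nE G) → Subset (nE G) → Subset (nE G)
  X ⊕ Y = tabulate (λ e → lookup X e xor lookup Y e)

  without : Subset (nE G) → E → Subset (nE G)
  without X g = tabulate (λ e → lookup X e ∧ not ⌊ e ≟ g ⌋)

  lookup-⊕ : ∀ X Y e → lookup (X ⊕ Y) e ≡ (lookup X e xor lookup Y e)
  lookup-⊕ X Y e = lookup∘tabulate (λ e → lookup X e xor lookup Y e) e

  lookup-without : ∀ X {g e} → e ≢ g → lookup (without X g) e ≡ lookup X e
  lookup-without X {g} {e} e≢g = trans (lookup∘tabulate (λ e → lookup X e ∧ not ⌊ e ≟ g ⌋) e)
    (trans (cong (λ z → lookup X e ∧ not z) (⌊⌋-false (e ≟ g) e≢g)) (∧-identityʳ _))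

  deg-⊕ : ∀ X Y v → deg G (X ⊕ Y) v + ∣ (Y ∩ δ G v) ∩ X ∣ ≡ deg G X v + ∣ (Y ∩ δ G v) ∩ ∁ X ∣
  deg-⊕ X Y v = card-+-pointwise ((X ⊕ Y) ∩ δ G v) ((Y ∩ δ G v) ∩ X) (X ∩ δ G v) ((Y ∩ δ G v) ∩ ∁ X) pointwise
    where
    boolean : ∀ x y i → 𝟙 ((x xor y) ∧ i) + 𝟙 ((y ∧ i) ∧ x) ≡ 𝟙 (x ∧ i) + 𝟙 ((y ∧ i) ∧ not x)
    boolean true true true = refl
    boolean true true false = refl
    boolean true false i = refl
    boolean false true true = refl
    boolean false true false = refl
    boolean false false i = refl
    pointwise : ∀ e → 𝟙 (lookup ((X ⊕ Y) ∩ δ G v) e) + 𝟙 (lookup ((Y ∩ δ G v) ∩ X) e)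
                    ≡ 𝟙 (lookup (X ∩ δ G v) e) + 𝟙 (lookup ((Y ∩ δ G v) ∩ ∁ X) e)
    pointwise e rewrite lookup-∩ (X ⊕ Y) (δ G v) e | lookup-∩ (Y ∩ δ G v) X e | lookup-∩ X (δ G v) e
                      | lookup-∩ (Y ∩ δ G v) (∁ X) e | lookup-∩ Y (δ G v) e | lookup-∁ X e
                      | lookup∘tabulate (λ e → lookup X e xor lookup Y e) e
      = boolean (lookup X e) (lookup Y e) (lookup (δ G v) e)

  card-⊕ : ∀ X Y → ∣ X ⊕ Y ∣ + ∣ Y ∩ X ∣ ≡ ∣ X ∣ + ∣ Y ∩ ∁ X ∣
  card-⊕ X Y = card-+-pointwise (X ⊕ Y) (Y ∩ X) X (Y ∩ ∁ X) pointwise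
    where
    boolean : ∀ x y → 𝟙 (x xor y) + 𝟙 (y ∧ x) ≡ 𝟙 x + 𝟙 (y ∧ not x)
    boolean true true = refl
    boolean true false = refl
    boolean false true = refl
    boolean false false = refl
    pointwise : ∀ e → 𝟙 (lookup (X ⊕ Y) e) + 𝟙 (lookup (Y ∩ X) e) ≡ 𝟙 (lookup X e) + 𝟙 (lookup (Y ∩ ∁ X) e)
    pointwise e rewrite lookup-∩ Y X e | lookup-∩ Y (∁ X) e | lookup-∁ X e
                      | lookup∘tabulate (λ e → lookup X e xor lookup Y e) e
      = boolean (lookup X e) (lookup Y e)

  deg-without : ∀ X g v → lookup X g ≡ true → deg G (without X g) v + 𝟙 (incident v g) ≡ deg G X v
  deg-without X g v Xg = begin
    deg G (without X g) v + 𝟙 (incident v g)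
      ≡⟨ cong₂ _+_ (deg-sum (without X g) v) (sym single) ⟩
    sum (λ e → 𝟙 (lookup (without X g) e ∧ incident v e)) + sum (λ e → 𝟙 (⌊ e ≟ g ⌋ ∧ incident v e))
      ≡⟨ ∑-distrib-+ (λ e → 𝟙 (lookup (without X g) e ∧ incident v e)) _ ⟨
    sum (λ e → 𝟙 (lookup (without X g) e ∧ incident v e) + 𝟙 (⌊ e ≟ g ⌋ ∧ incident v e))
      ≡⟨ sum-cong-≗ pointwise ⟩
    sum (λ e → 𝟙 (lookup X e ∧ incident v e))
      ≡⟨ deg-sum X v ⟨
    deg G X v ∎
    where
    open ≡-Reasoning
    single : sum (λ e → 𝟙 (⌊ e ≟ g ⌋ ∧ incident v e)) ≡ 𝟙 (incident v g)
    single = trans (sum-single g (λ e e≢g → cong (λ z → 𝟙 (z ∧ incident v e)) (⌊⌋-false (e ≟ g) e≢g)))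
                   (cong (λ z → 𝟙 (z ∧ incident v g)) (⌊⌋-true (g ≟ g) refl))
    pointwise : ∀ e → 𝟙 (lookup (without X g) e ∧ incident v e) + 𝟙 (⌊ e ≟ g ⌋ ∧ incident v e)
                    ≡ 𝟙 (lookup X e ∧ incident v e)
    pointwise e rewrite lookup∘tabulate (λ e → lookup X e ∧ not ⌊ e ≟ g ⌋) e with e ≟ g
    ... | yes refl rewrite Xg = refl
    ... | no _ rewrite ∧-identityʳ (lookup X e) = +-identityʳ _

  card-without : ∀ X g → lookup X g ≡ true → ∣ without X g ∣ + 1 ≡ ∣ X ∣
  card-without X g Xg = begin
    ∣ without X g ∣ + 1
      ≡⟨ cong₂ _+_ (card (without X g)) (sym single) ⟩
    sum (𝟙 ∘ lookup (without X g)) + sum (λ e → 𝟙 ⌊ e ≟ g ⌋)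
      ≡⟨ ∑-distrib-+ (𝟙 ∘ lookup (without X g)) _ ⟨
    sum (λ e → 𝟙 (lookup (without X g) e) + 𝟙 ⌊ e ≟ g ⌋)
      ≡⟨ sum-cong-≗ pointwise ⟩
    sum (𝟙 ∘ lookup X)
      ≡⟨ card X ⟨
    ∣ X ∣ ∎
    where
    open ≡-Reasoning
    single : sum (λ e → 𝟙 ⌊ e ≟ g ⌋) ≡ 1
    single = trans (sum-single g (λ e e≢g → cong 𝟙 (⌊⌋-false (e ≟ g) e≢g))) (cong 𝟙 (⌊⌋-true (g ≟ g) refl))
    pointwise : ∀ e → 𝟙 (lookup (without X g) e) + 𝟙 ⌊ e ≟ g ⌋ ≡ 𝟙 (lookup X e)
    pointwise e rewrite lookup∘tabulate (λ e → lookup X e ∧ not ⌊ e ≟ g ⌋) e with e ≟ g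
    ... | yes refl rewrite Xg = refl
    ... | no _ rewrite ∧-identityʳ (lookup X e) = +-identityʳ _

module Alternation (G : Graph) (M : Subset (nE G)) where

  open Incidence G
  open Paths G
  open SymmetricDifference G

  atM atN : ∀ {L} → IPath L → V → ℕ
  atM Q v = count Q (λ e → incident v e ∧ lookup M e)
  atN Q v = count Q (λ e → incident v e ∧ not (lookup M e))

  IsWedge : ∀ {L} → IPath L → Set
  IsWedge Q = ∀ v → On Q v → atM Q v + 𝟙 (last Q == v) ≡ 1

  IsExposed : ∀ {L} → IPath L → Set
  IsExposed Q = ∀ v → On Q v → atN Q v ≡ 1

  at-vertex : ∀ {L} (Q : IPath L) v → On Q v →
    (atM Q v + 𝟙 (last Q == v)) + (atN Q v + 𝟙 (first Q == v)) ≡ 2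
  at-vertex Q v o = begin
    (atM Q v + 𝟙 (last Q == v)) + (atN Q v + 𝟙 (first Q == v))
      ≡⟨ regroup (atM Q v) (atN Q v) (𝟙 (first Q == v)) (𝟙 (last Q == v)) ⟩
    atM Q v + atN Q v + 𝟙 (first Q == v) + 𝟙 (last Q == v)
      ≡⟨ cong (λ z → z + 𝟙 (first Q == v) + 𝟙 (last Q == v)) (count-split Q v (lookup M)) ⟩
    count Q (incident v) + 𝟙 (first Q == v) + 𝟙 (last Q == v)
      ≡⟨ path-degree Q v o ⟩
    2 ∎
    where
    open ≡-Reasoning
    regroup : ∀ a b c d → (a + d) + (b + c) ≡ a + b + c + d
    regroup = solve-∀

  count-first : ∀ {L} (Q : IPath (suc L)) (Y : E → Bool) →
    count Q (λ e → incident (first Q) e ∧ Y e) ≡ 𝟙 (Y (ed Q zero))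
  count-first Q Y
    rewrite incident-joins (first Q) (ed-joins Q zero) | ==-refl (first Q)
          | count-off (tail Q) (first Q) Y (λ o → on-tail≢first Q o refl) = +-identityʳ _

  count-tail : ∀ {L} (Q : IPath (suc L)) v (Y : E → Bool) → Y (ed Q zero) ≡ false →
    count Q (λ e → incident v e ∧ Y e) ≡ count (tail Q) (λ e → incident v e ∧ Y e)
  count-tail Q v Y Y₀ = cong (λ z → 𝟙 z + count (tail Q) (λ e → incident v e ∧ Y e))
    (trans (cong (incident v (ed Q zero) ∧_) Y₀) (∧-zeroʳ _))

  wedge-atN : ∀ {L} (Q : IPath L) → IsWedge Q → ∀ v → On Q v → atN Q v + 𝟙 (first Q == v) ≡ 1
  wedge-atN Q w v o = +-cancelˡ-≡ 1 _ _ (trans (cong (_+ (atN Q v + 𝟙 (first Q == v))) (sym (w v o))) (at-vertex Q v o))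

  exposed-atM : ∀ {L} (Q : IPath L) → IsExposed Q → ∀ v → On Q v →
    atM Q v + 𝟙 (last Q == v) + 𝟙 (first Q == v) ≡ 1
  exposed-atM Q x v o = suc-injective (begin
    suc (atM Q v + 𝟙 (last Q == v) + 𝟙 (first Q == v))   ≡⟨ +-suc _ _ ⟨
    (atM Q v + 𝟙 (last Q == v)) + suc (𝟙 (first Q == v)) ≡⟨ cong (λ n → (atM Q v + 𝟙 (last Q == v)) + (n + 𝟙 (first Q == v))) (x v o) ⟨
    (atM Q v + 𝟙 (last Q == v)) + (atN Q v + 𝟙 (first Q == v)) ≡⟨ at-vertex Q v o ⟩
    2 ∎)
    where open ≡-Reasoning

  exposed-nontrivial : (Q : IPath 0) → ¬ IsExposed Q
  exposed-nontrivial Q x with x (first Q) (zero , refl)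
  ... | ()

  wedge-step : ∀ {L} (Q : IPath (suc L)) → IsWedge Q → lookup M (ed Q zero) ≡ true × IsExposed (tail Q)
  wedge-step Q w = M₀ , exposed
    where
    M₀ : lookup M (ed Q zero) ≡ true
    M₀ = 𝟙≡1 (begin
      𝟙 (lookup M (ed Q zero))                      ≡⟨ count-first Q (lookup M) ⟨
      atM Q (first Q)                               ≡⟨ +-identityʳ _ ⟨
      atM Q (first Q) + 0                           ≡⟨ cong (λ b → atM Q (first Q) + 𝟙 b) (==-false (last≢first Q)) ⟨
      atM Q (first Q) + 𝟙 (last Q == first Q)       ≡⟨ w (first Q) (zero , refl) ⟩
      1 ∎)
      where open ≡-Reasoning
    exposed : IsExposed (tail Q)
    exposed v o = begin
      atN (tail Q) v                       ≡⟨ count-tail Q v (not ∘ lookup M) (cong not M₀) ⟨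
      atN Q v                              ≡⟨ +-identityʳ _ ⟨
      atN Q v + 0                          ≡⟨ cong (λ b → atN Q v + 𝟙 b) (==-false (on-tail≢first Q o ∘ sym)) ⟨
      atN Q v + 𝟙 (first Q == v)           ≡⟨ wedge-atN Q w v (on-tail Q o) ⟩
      1 ∎
      where open ≡-Reasoning

  exposed-step : ∀ {L} (Q : IPath (suc L)) → IsExposed Q → lookup M (ed Q zero) ≡ false × IsWedge (tail Q)
  exposed-step Q x = M₀ , wedge
    where
    M₀ : lookup M (ed Q zero) ≡ false
    M₀ with lookup M (ed Q zero) | trans (sym (count-first Q (not ∘ lookup M))) (x (first Q) (zero , refl))
    ... | false | _ = refl
    wedge : IsWedge (tail Q)
    wedge v o = begin
      atM (tail Q) v + 𝟙 (last Q == v)                          ≡⟨ cong (_+ 𝟙 (last Q == v)) (count-tail Q v (lookup M) M₀) ⟨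
      atM Q v + 𝟙 (last Q == v)                                 ≡⟨ +-identityʳ _ ⟨
      atM Q v + 𝟙 (last Q == v) + 0                             ≡⟨ cong (λ b → atM Q v + 𝟙 (last Q == v) + 𝟙 b) (==-false (on-tail≢first Q o ∘ sym)) ⟨
      atM Q v + 𝟙 (last Q == v) + 𝟙 (first Q == v)              ≡⟨ exposed-atM Q x v (on-tail Q o) ⟩
      1 ∎
      where open ≡-Reasoning

  mutual
    wedge-balance : ∀ {L} (Q : IPath L) → IsWedge Q → count Q (lookup M) ≡ count Q (not ∘ lookup M)
    wedge-balance {zero} Q w = refl
    wedge-balance {suc L} Q w with wedge-step Q w
    ... | M₀ , x rewrite M₀ = sym (exposed-balance (tail Q) x)

    exposed-balance : ∀ {L} (Q : IPath L) → IsExposed Q → count Q (not ∘ lookup M) ≡ suc (count Q (lookup M))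
    exposed-balance {zero} Q x = ⊥-elim (exposed-nontrivial Q x)
    exposed-balance {suc L} Q x with exposed-step Q x
    ... | M₀ , w rewrite M₀ = cong suc (sym (wedge-balance (tail Q) w))

  module Colours (inA : V → Bool) (bip : ∀ e → inA (end₁ G e) ≢ inA (end₂ G e)) where

    joins-colours : ∀ {e a w} → Joins G e a w → inA a ≢ inA w
    joins-colours {e} (inj₁ (refl , refl)) = bip e
    joins-colours {e} (inj₂ (refl , refl)) = bip e ∘ sym

    ≢-≢ : ∀ {a c d : Bool} → a ≢ c → c ≢ d → a ≡ d
    ≢-≢ {false} {false} p _ = ⊥-elim (p refl)
    ≢-≢ {false} {true} {false} _ _ = refl
    ≢-≢ {false} {true} {true} _ q = ⊥-elim (q refl)
    ≢-≢ {true} {true} p _ = ⊥-elim (p refl)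
    ≢-≢ {true} {false} {true} _ _ = refl
    ≢-≢ {true} {false} {false} _ q = ⊥-elim (q refl)

    mutual
      wedge-colour : ∀ {L} (Q : IPath L) → IsWedge Q → inA (first Q) ≡ inA (last Q)
      wedge-colour {zero} Q w = refl
      wedge-colour {suc L} Q w = ≢-≢ (joins-colours (ed-joins Q zero)) (exposed-colour (tail Q) (proj₂ (wedge-step Q w)))

      exposed-colour : ∀ {L} (Q : IPath L) → IsExposed Q → inA (first Q) ≢ inA (last Q)
      exposed-colour {zero} Q x = ⊥-elim (exposed-nontrivial Q x)
      exposed-colour {suc L} Q x eq =
        joins-colours (ed-joins Q zero) (trans eq (sym (wedge-colour (tail Q) (proj₂ (exposed-step Q x)))))

  switch : ∀ {L} → IPath L → Subset (nE G)
  switch Q = M ⊕ pathEdges G (asPath Q)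

  atN-∁ : ∀ {L} (Q : IPath L) v → count Q (λ e → incident v e ∧ lookup (∁ M) e) ≡ atN Q v
  atN-∁ Q v = count-cong Q (λ e → cong (incident v e ∧_) (lookup-∁ M e))

  switch-deg : ∀ {L} (Q : IPath L) v → deg G (switch Q) v + atM Q v ≡ deg G M v + atN Q v
  switch-deg Q v = begin
    deg G (switch Q) v + atM Q v                                      ≡⟨ cong (deg G (switch Q) v +_) (card-δP Q v M) ⟨
    deg G (switch Q) v + ∣ δP G (asPath Q) v ∩ M ∣                    ≡⟨ deg-⊕ M (pathEdges G (asPath Q)) v ⟩
    deg G M v + ∣ δP G (asPath Q) v ∩ ∁ M ∣                           ≡⟨ cong (deg G M v +_) (trans (card-δP Q v (∁ M)) (atN-∁ Q v)) ⟩
    deg G M v + atN Q v ∎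
    where open ≡-Reasoning

  switch-deg-off : ∀ {L} (Q : IPath L) v → ¬ On Q v → deg G (switch Q) v ≡ deg G M v
  switch-deg-off Q v v∉Q = +-cancelʳ-≡ 0 _ _ (begin
    deg G (switch Q) v + 0         ≡⟨ cong (deg G (switch Q) v +_) (count-off Q v (lookup M) v∉Q) ⟨
    deg G (switch Q) v + atM Q v   ≡⟨ switch-deg Q v ⟩
    deg G M v + atN Q v            ≡⟨ cong (deg G M v +_) (count-off Q v (not ∘ lookup M) v∉Q) ⟩
    deg G M v + 0 ∎)
    where open ≡-Reasoning

  switch-card : ∀ {L} (Q : IPath L) → ∣ switch Q ∣ + count Q (lookup M) ≡ ∣ M ∣ + count Q (not ∘ lookup M)
  switch-card Q = begin
    ∣ switch Q ∣ + count Q (lookup M)                   ≡⟨ cong (∣ switch Q ∣ +_) (card-pathEdges Q M) ⟨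
    ∣ switch Q ∣ + ∣ pathEdges G (asPath Q) ∩ M ∣       ≡⟨ card-⊕ M (pathEdges G (asPath Q)) ⟩
    ∣ M ∣ + ∣ pathEdges G (asPath Q) ∩ ∁ M ∣            ≡⟨ cong (∣ M ∣ +_) (trans (card-pathEdges Q (∁ M)) (count-cong Q (lookup-∁ M))) ⟩
    ∣ M ∣ + count Q (not ∘ lookup M) ∎
    where open ≡-Reasoning

  wedge-switch-deg : ∀ {L} (Q : IPath L) → IsWedge Q → ∀ v → On Q v →
    deg G (switch Q) v + 𝟙 (first Q == v) ≡ deg G M v + 𝟙 (last Q == v)
  wedge-switch-deg Q w v o = +-cancelʳ-≡ 1 _ _ (begin
    d′ + s + 1                   ≡⟨ cong (d′ + s +_) (w v o) ⟨
    d′ + s + (cM + f)            ≡⟨ regroup₁ d′ s cM f ⟩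
    (d′ + cM) + (s + f)          ≡⟨ cong (_+ (s + f)) (switch-deg Q v) ⟩
    (d + cN) + (s + f)           ≡⟨ regroup₂ d cN s f ⟩
    d + f + (cN + s)             ≡⟨ cong (d + f +_) (wedge-atN Q w v o) ⟩
    d + f + 1 ∎)
    where
    open ≡-Reasoning
    d′ = deg G (switch Q) v
    d = deg G M v
    cM = atM Q v
    cN = atN Q v
    s = 𝟙 (first Q == v)
    f = 𝟙 (last Q == v)
    regroup₁ : ∀ a b c d → a + b + (c + d) ≡ (a + c) + (b + d)
    regroup₁ = solve-∀
    regroup₂ : ∀ a b c d → (a + b) + (c + d) ≡ a + d + (b + c)
    regroup₂ = solve-∀

  wedge-switch-card : ∀ {L} (Q : IPath L) → IsWedge Q → ∣ switch Q ∣ ≡ ∣ M ∣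
  wedge-switch-card Q w = +-cancelʳ-≡ _ _ _ (trans (switch-card Q) (cong (∣ M ∣ +_) (sym (wedge-balance Q w))))

  exposed-switch-deg : ∀ {L} (Q : IPath L) → IsExposed Q → ∀ v → On Q v →
    deg G (switch Q) v ≡ deg G M v + 𝟙 (last Q == v) + 𝟙 (first Q == v)
  exposed-switch-deg Q x v o = +-cancelʳ-≡ (atM Q v) _ _ (begin
    deg G (switch Q) v + atM Q v    ≡⟨ switch-deg Q v ⟩
    deg G M v + atN Q v             ≡⟨ cong (deg G M v +_) (trans (x v o) (sym (exposed-atM Q x v o))) ⟩
    deg G M v + (atM Q v + f + s)   ≡⟨ regroup (deg G M v) (atM Q v) f s ⟩
    deg G M v + f + s + atM Q v ∎)
    where
    open ≡-Reasoning
    s = 𝟙 (first Q == v)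
    f = 𝟙 (last Q == v)
    regroup : ∀ a b c d → a + (b + c + d) ≡ a + c + d + b
    regroup = solve-∀

  exposed-switch-card : ∀ {L} (Q : IPath L) → IsExposed Q → ∣ switch Q ∣ ≡ suc ∣ M ∣
  exposed-switch-card Q x = +-cancelʳ-≡ _ _ _
    (trans (switch-card Q) (trans (cong (∣ M ∣ +_) (exposed-balance Q x)) (+-suc ∣ M ∣ _)))

  -- The only edge of an exposed path at its first vertex is its first edge,
  -- which is not in M; so no M-edge at the first vertex lies on the path.
  exposed-first-M-off : ∀ {L} (Q : IPath (suc L)) → IsExposed Q → ∀ {g} → lookup M g ≡ true →
    incident (first Q) g ≡ true → lookup (pathEdges G (asPath Q)) g ≡ false
  exposed-first-M-off Q x {g} g∈M y∈g with lookup (pathEdges G (asPath Q)) g in g∈Q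
  ... | false = refl
  ... | true = ⊥-elim (<-irrefl refl (subst (1 ≤_) (trans (card-δP Q (first Q) M) atM-first)
                 (member-card (δP G (asPath Q) (first Q) ∩ M) g∈δP∩M)))
    where
    atM-first : atM Q (first Q) ≡ 0
    atM-first = trans (count-first Q (lookup M)) (cong 𝟙 (proj₁ (exposed-step Q x)))
    g∈δP∩M : lookup (δP G (asPath Q) (first Q) ∩ M) g ≡ true
    g∈δP∩M rewrite lookup-∩ (δP G (asPath Q) (first Q)) M g | lookup-∩ (pathEdges G (asPath Q)) (δ G (first Q)) g
                 | lookup-δ (first Q) g | g∈Q | y∈g | g∈M = refl

  exposed-first-switched : ∀ {L} (Q : IPath (suc L)) → IsExposed Q → lookup (switch Q) (ed Q zero) ≡ true
  exposed-first-switched Q x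
    rewrite lookup-⊕ M (pathEdges G (asPath Q)) (ed Q zero)
          | lookup∘tabulate (λ e → ⌊ any? (λ i → ed Q i ≟ e) ⌋) (ed Q zero)
          | ⌊⌋-true (any? (λ i → ed Q i ≟ ed Q zero)) (zero , refl) | proj₁ (exposed-step Q x) = refl

  exposed-reverse : ∀ {L} (Q : IPath L) → IsExposed Q → IsExposed (reverse Q)
  exposed-reverse Q x v o = begin
    atN (reverse Q) v                                          ≡⟨ atN-∁ (reverse Q) v ⟨
    count (reverse Q) (λ e → incident v e ∧ lookup (∁ M) e)    ≡⟨ count-reverse Q v (∁ M) ⟩
    count Q (λ e → incident v e ∧ lookup (∁ M) e)              ≡⟨ atN-∁ Q v ⟩
    atN Q v                                                    ≡⟨ x v (on-reverse Q o) ⟩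
    1 ∎
    where open ≡-Reasoning

  wedge-atM-last : ∀ {L} (Q : IPath L) → IsWedge Q → atM Q (last Q) ≡ 0
  wedge-atM-last {L} Q w = +-cancelʳ-≡ 1 _ 0
    (trans (cong (λ z → atM Q (last Q) + 𝟙 z) (sym (==-refl (last Q)))) (w (last Q) (fromℕ L , refl)))

  wedge-atM-inner : ∀ {L} (Q : IPath L) → IsWedge Q → ∀ v → On Q v → v ≢ last Q → atM Q v ≡ 1
  wedge-atM-inner Q w v o v≢last =
    trans (sym (+-identityʳ _)) (trans (cong (λ z → atM Q v + 𝟙 z) (sym (==-false (v≢last ∘ sym)))) (w v o))

  wedge-of : ∀ P {x u} → Wedge G M P x u → first (ofPath P) ≡ x × last (ofPath P) ≡ u × IsWedge (ofPath P)
  wedge-of P (s , refl , inner , end) = s , refl , wedge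
    where
    wedge : IsWedge (ofPath P)
    wedge v o with last (ofPath P) ≟ v
    ... | yes refl = cong (_+ 1) (trans (sym (card-δP (ofPath P) v M)) end)
    ... | no last≢v = trans (+-identityʳ _) (trans (sym (card-δP (ofPath P) v M)) (inner v o (last≢v ∘ sym)))

  as-wedge : ∀ {L} (Q : IPath L) → IsWedge Q → Wedge G M (asPath Q) (first Q) (last Q)
  as-wedge Q w = refl , refl , (λ v o v≢last → trans (card-δP Q v M) (wedge-atM-inner Q w v o v≢last))
               , trans (card-δP Q (last Q) M) (wedge-atM-last Q w)

  exposed-ofPath : ∀ P → (∀ v → OnPath G P v → ∣ δP G P v ∩ ∁ M ∣ ≡ 1) → IsExposed (ofPath P)
  exposed-ofPath P h v o = trans (sym (trans (card-δP (ofPath P) v (∁ M)) (atN-∁ (ofPath P) v))) (h v o)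

  exposed-of : ∀ P {y u} → Exposed G M P y u →
    ∃ λ L → ∃ λ (Q : IPath L) → first Q ≡ y × last Q ≡ u × IsExposed Q
  exposed-of P (inj₁ (s , f) , h) = len P , ofPath P , s , f , exposed-ofPath P h
  exposed-of P (inj₂ (s , f) , h) =
    len P , reverse (ofPath P) , f , trans (last-reverse (ofPath P)) s , exposed-reverse (ofPath P) (exposed-ofPath P h)

  as-exposed : ∀ {L} (Q : IPath L) → IsExposed Q → Exposed G M (asPath Q) (first Q) (last Q)
  as-exposed Q x = inj₁ (refl , refl) , λ v o → trans (trans (card-δP Q v (∁ M)) (atN-∁ Q v)) (x v o)

-- Existence of a path with a decidable property is decidable: a path has
-- fewer than nV edges, so it suffices to enumerate vertex and edge
-- sequences of bounded length.
module PathSearch (G : Graph) where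

  open Incidence G
  open Paths G

  Respects : (∀ {L} → IPath L → Set) → Set
  Respects P = ∀ {L} (Q Q′ : IPath L) → (∀ i → vt Q i ≡ vt Q′ i) → (∀ i → ed Q i ≡ ed Q′ i) → P Q → P Q′

  exists-vec : ∀ {k} n (P : Vec (Fin k) n → Set) → (∀ xs → Dec (P xs)) → Dec (∃ P)
  exists-vec zero P P? with P? []
  ... | yes p = yes ([] , p)
  ... | no ¬p = no λ { ([] , p) → ¬p p }
  exists-vec (suc n) P P? with any? (λ a → exists-vec n (P ∘ (a ∷_)) (P? ∘ (a ∷_)))
  ... | yes (a , xs , p) = yes (a ∷ xs , p)
  ... | no ¬p = no λ { (a ∷ xs , p) → ¬p (a , xs , p) }

  Chain : ∀ {n} → Vec V (suc n) → Vec E n → Set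
  Chain vs es = ∀ i → Joins G (lookup es i) (lookup vs (inject₁ i)) (lookup vs (suc i))

  fromVecs : ∀ {n} (vs : Vec V (suc n)) (es : Vec E n) → Injective _≡_ _≡_ (lookup vs) → Chain vs es → IPath n
  fromVecs vs es vs-inj chain = record { vt = lookup vs ; vt-inj = vs-inj ; ed = lookup es ; ed-joins = chain }

  injective? : ∀ {n} (vs : Vec V n) → Dec (Injective _≡_ _≡_ (lookup vs))
  injective? vs = map′ (λ h {i} {j} → h i j) (λ h i j → h {i} {j})
    (all? (λ i → all? (λ j → (lookup vs i ≟ lookup vs j) →-dec (i ≟ j))))

  joins? : ∀ e a w → Dec (Joins G e a w)
  joins? e a w = ((end₁ G e ≟ a) ×-dec (end₂ G e ≟ w)) ⊎-dec ((end₁ G e ≟ w) ×-dec (end₂ G e ≟ a))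

  module _ (P : ∀ {L} → IPath L → Set) (respects : Respects P) (P? : ∀ {L} (Q : IPath L) → Dec (P Q)) where

    Witness : ℕ → Set
    Witness n = ∃ λ (vs : Vec V (suc n)) → ∃ λ (es : Vec E n) →
      Σ (Injective _≡_ _≡_ (lookup vs)) λ vs-inj → Σ (Chain vs es) λ chain → P (fromVecs vs es vs-inj chain)

    witness? : ∀ n → Dec (Witness n)
    witness? n = exists-vec (suc n) _ λ vs → exists-vec n _ λ es → decide vs es
      where
      decide : ∀ vs es → Dec (Σ (Injective _≡_ _≡_ (lookup vs)) λ vs-inj →
                               Σ (Chain vs es) λ chain → P (fromVecs vs es vs-inj chain))
      decide vs es with injective? vs | all? (λ i → joins? (lookup es i) (lookup vs (inject₁ i)) (lookup vs (suc i)))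
      ... | no ¬inj | _ = no λ { (vs-inj , _) → ¬inj vs-inj }
      ... | yes _ | no ¬chain = no λ { (_ , chain , _) → ¬chain chain }
      ... | yes vs-inj | yes chain with P? (fromVecs vs es vs-inj chain)
      ...   | yes p = yes (vs-inj , chain , p)
      ...   | no ¬p = no λ { (vs-inj′ , chain′ , p) →
                ¬p (respects (fromVecs vs es vs-inj′ chain′) _ (λ _ → refl) (λ _ → refl) p) }

    witness-of : ∀ {L} (Q : IPath L) → P Q → Witness L
    witness-of Q p = tabulate (vt Q) , tabulate (ed Q) , vs-inj , chain ,
                     respects Q _ (sym ∘ lookup∘tabulate (vt Q)) (sym ∘ lookup∘tabulate (ed Q)) p
      where
      vs-inj : Injective _≡_ _≡_ (lookup (tabulate (vt Q)))
      vs-inj {i} {j} eq = vt-inj Q (trans (sym (lookup∘tabulate (vt Q) i)) (trans eq (lookup∘tabulate (vt Q) j)))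
      chain : Chain (tabulate (vt Q)) (tabulate (ed Q))
      chain i = subst₂ (Joins G (lookup (tabulate (ed Q)) i))
                  (sym (lookup∘tabulate (vt Q) _)) (sym (lookup∘tabulate (vt Q) _))
                  (subst (λ e → Joins G e _ _) (sym (lookup∘tabulate (ed Q) i)) (ed-joins Q i))

    path-search : Dec (∃ λ L → ∃ λ (Q : IPath L) → P Q)
    path-search with anyUpTo? witness? (nV G)
    ... | yes (n , _ , vs , es , vs-inj , chain , p) = yes (n , fromVecs vs es vs-inj chain , p)
    ... | no none = no λ { (L , Q , p) → none (L , Finₚ.injective⇒≤ (vt-inj Q) , witness-of Q p) }


-- For a vertex set Z of a loopless graph and
-- an edge set X, every edge of X either lies in E[Z] or has an end outside Z,
-- which gives the handshake identity
--   |X| + |X ∩ E[∁Z]| = Σ_{v ∉ Z} deg_X v + |X ∩ E[Z]|.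
-- Hence |X| ≤ b(∁Z) + |E[Z]| for every b-matching X, with equality exactly
-- when X is tight for Z: it saturates every vertex outside Z, contains
-- E[Z], and has no edge with both ends outside Z.
module Duality (G : Graph) (b : Fin (nV G) → ℕ) (loopless : ∀ e → end₁ G e ≢ end₂ G e)
               (Z : Subset (nV G)) where

  open Incidence G

  out : V → Bool
  out v = not (lookup Z v)

  outerDeg : Subset (nE G) → ℕ
  outerDeg X = sum (λ v → if lookup Z v then 0 else deg G X v)

  outerB : ℕ
  outerB = sum (λ v → if lookup Z v then 0 else b v)

  outerB-bsum : bsum G b (∁ Z) ≡ outerB
  outerB-bsum = trans (sum-allFin (nV G) _) (sum-cong-≗ pointwise)
    where
    pointwise : ∀ v → (if lookup (∁ Z) v then b v else 0) ≡ (if lookup Z v then 0 else b v)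
    pointwise v rewrite lookup-∁ Z v with lookup Z v
    ... | true = refl
    ... | false = refl

  outerDeg-edges : ∀ X → outerDeg X ≡ sum (λ e → 𝟙 (lookup X e ∧ out (end₁ G e)) + 𝟙 (lookup X e ∧ out (end₂ G e)))
  outerDeg-edges X = begin
    outerDeg X                                                   ≡⟨ sum-cong-≗ as-sum ⟩
    sum (λ v → sum (λ e → 𝟙 (out v ∧ (lookup X e ∧ incident v e)))) ≡⟨ ∑-comm (λ v e → 𝟙 (out v ∧ (lookup X e ∧ incident v e))) ⟩
    sum (λ e → sum (λ v → 𝟙 (out v ∧ (lookup X e ∧ incident v e)))) ≡⟨ sum-cong-≗ per-edge ⟩
    sum (λ e → 𝟙 (lookup X e ∧ out (end₁ G e)) + 𝟙 (lookup X e ∧ out (end₂ G e))) ∎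
    where
    open ≡-Reasoning
    as-sum : ∀ v → (if lookup Z v then 0 else deg G X v) ≡ sum (λ e → 𝟙 (out v ∧ (lookup X e ∧ incident v e)))
    as-sum v with lookup Z v
    ... | true = sym (sum-zero {f = λ e → 𝟙 (false ∧ (lookup X e ∧ incident v e))} (λ _ → refl))
    ... | false = deg-sum X v
    at-end : ∀ e w → sum (λ v → 𝟙 (out v ∧ (lookup X e ∧ (w == v)))) ≡ 𝟙 (lookup X e ∧ out w)
    at-end e w = trans (sum-single w (λ v v≢w → trans (cong (λ z → 𝟙 (out v ∧ (lookup X e ∧ z))) (==-false (v≢w ∘ sym)))
                                          (cong 𝟙 (trans (cong (out v ∧_) (∧-zeroʳ (lookup X e))) (∧-zeroʳ (out v))))))
                       (trans (cong (λ z → 𝟙 (out w ∧ (lookup X e ∧ z))) (==-refl w)) (boolean (out w) (lookup X e)))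
      where
      boolean : ∀ a x → 𝟙 (a ∧ (x ∧ true)) ≡ 𝟙 (x ∧ a)
      boolean true true = refl
      boolean true false = refl
      boolean false true = refl
      boolean false false = refl
    disjoint : ∀ a x p q → (p ∧ q) ≡ false → 𝟙 (a ∧ (x ∧ (p ∨ q))) ≡ 𝟙 (a ∧ (x ∧ p)) + 𝟙 (a ∧ (x ∧ q))
    disjoint true true true true ()
    disjoint true true true false _ = refl
    disjoint true true false q _ = refl
    disjoint true false p q _ = refl
    disjoint false x p q _ = refl
    not-both : ∀ e v → ((end₁ G e == v) ∧ (end₂ G e == v)) ≡ false
    not-both e v with end₁ G e ≟ v | end₂ G e ≟ v
    ... | yes p | yes q = ⊥-elim (loopless e (trans p (sym q)))
    ... | yes _ | no _ = refl
    ... | no _ | _ = refl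
    per-edge : ∀ e → sum (λ v → 𝟙 (out v ∧ (lookup X e ∧ incident v e)))
                   ≡ 𝟙 (lookup X e ∧ out (end₁ G e)) + 𝟙 (lookup X e ∧ out (end₂ G e))
    per-edge e = trans (sum-cong-≗ (λ v → disjoint (out v) (lookup X e) _ _ (not-both e v)))
                   (trans (∑-distrib-+ (λ v → 𝟙 (out v ∧ (lookup X e ∧ (end₁ G e == v)))) _)
                          (cong₂ _+_ (at-end e (end₁ G e)) (at-end e (end₂ G e))))

  lookup-EIn : ∀ (W : Subset (nV G)) e → lookup (EIn G b W) e ≡ (lookup W (end₁ G e) ∧ lookup W (end₂ G e))
  lookup-EIn W e = lookup∘tabulate _ e

  handshake : ∀ X → ∣ X ∣ + ∣ X ∩ EIn G b (∁ Z) ∣ ≡ outerDeg X + ∣ X ∩ EIn G b Z ∣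
  handshake X = begin
    ∣ X ∣ + ∣ X ∩ EIn G b (∁ Z) ∣
      ≡⟨ cong₂ _+_ (card X) (card (X ∩ EIn G b (∁ Z))) ⟩
    sum (𝟙 ∘ lookup X) + sum (𝟙 ∘ lookup (X ∩ EIn G b (∁ Z)))
      ≡⟨ ∑-distrib-+ (𝟙 ∘ lookup X) _ ⟨
    sum (λ e → 𝟙 (lookup X e) + 𝟙 (lookup (X ∩ EIn G b (∁ Z)) e))
      ≡⟨ sum-cong-≗ pointwise ⟩
    sum (λ e → (𝟙 (lookup X e ∧ out (end₁ G e)) + 𝟙 (lookup X e ∧ out (end₂ G e))) + 𝟙 (lookup (X ∩ EIn G b Z) e))
      ≡⟨ ∑-distrib-+ (λ e → 𝟙 (lookup X e ∧ out (end₁ G e)) + 𝟙 (lookup X e ∧ out (end₂ G e))) _ ⟩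
    sum (λ e → 𝟙 (lookup X e ∧ out (end₁ G e)) + 𝟙 (lookup X e ∧ out (end₂ G e))) + sum (𝟙 ∘ lookup (X ∩ EIn G b Z))
      ≡⟨ cong₂ _+_ (outerDeg-edges X) (card (X ∩ EIn G b Z)) ⟨
    outerDeg X + ∣ X ∩ EIn G b Z ∣ ∎
    where
    open ≡-Reasoning
    boolean : ∀ x z₁ z₂ → 𝟙 x + 𝟙 (x ∧ (not z₁ ∧ not z₂)) ≡ 𝟙 (x ∧ not z₁) + 𝟙 (x ∧ not z₂) + 𝟙 (x ∧ (z₁ ∧ z₂))
    boolean true true true = refl
    boolean true true false = refl
    boolean true false true = refl
    boolean true false false = refl
    boolean false z₁ z₂ = refl
    pointwise : ∀ e → 𝟙 (lookup X e) + 𝟙 (lookup (X ∩ EIn G b (∁ Z)) e)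
                    ≡ (𝟙 (lookup X e ∧ out (end₁ G e)) + 𝟙 (lookup X e ∧ out (end₂ G e))) + 𝟙 (lookup (X ∩ EIn G b Z) e)
    pointwise e rewrite lookup-∩ X (EIn G b (∁ Z)) e | lookup-EIn (∁ Z) e | lookup-∁ Z (end₁ G e)
                      | lookup-∁ Z (end₂ G e) | lookup-∩ X (EIn G b Z) e | lookup-EIn Z e
      = boolean (lookup X e) (lookup Z (end₁ G e)) (lookup Z (end₂ G e))

  record Tight (X : Subset (nE G)) : Set where
    field
      saturated : ∀ v → lookup Z v ≡ false → deg G X v ≡ b v
      inner-in : ∀ e → lookup Z (end₁ G e) ≡ true → lookup Z (end₂ G e) ≡ true → lookup X e ≡ true
      outer-out : ∀ e → lookup X e ≡ true → lookup Z (end₁ G e) ≡ false → lookup Z (end₂ G e) ≡ false → ⊥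

  inner-count : ∀ X → ∣ X ∩ EIn G b Z ∣ ≡ sum (λ e → 𝟙 (lookup X e ∧ (lookup Z (end₁ G e) ∧ lookup Z (end₂ G e))))
  inner-count X = trans (card (X ∩ EIn G b Z))
    (sum-cong-≗ (λ e → cong 𝟙 (trans (lookup-∩ X (EIn G b Z) e) (cong (lookup X e ∧_) (lookup-EIn Z e)))))

  outer-count : ∀ X → ∣ X ∩ EIn G b (∁ Z) ∣ ≡ sum (λ e → 𝟙 (lookup X e ∧ (out (end₁ G e) ∧ out (end₂ G e))))
  outer-count X = trans (card (X ∩ EIn G b (∁ Z)))
    (sum-cong-≗ (λ e → cong 𝟙 (trans (lookup-∩ X (EIn G b (∁ Z)) e)
      (cong (lookup X e ∧_) (trans (lookup-EIn (∁ Z) e) (cong₂ _∧_ (lookup-∁ Z _) (lookup-∁ Z _)))))))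

  EIn-count : ∣ EIn G b Z ∣ ≡ sum (λ e → 𝟙 (lookup Z (end₁ G e) ∧ lookup Z (end₂ G e)))
  EIn-count = trans (card (EIn G b Z)) (sum-cong-≗ (λ e → cong 𝟙 (lookup-EIn Z e)))

  tight-size : ∀ {X} → Tight X → ∣ X ∣ ≡ outerB + ∣ EIn G b Z ∣
  tight-size {X} T = begin
    ∣ X ∣                                  ≡⟨ +-identityʳ _ ⟨
    ∣ X ∣ + 0                              ≡⟨ cong (∣ X ∣ +_) (trans (outer-count X) (sum-zero no-outer)) ⟨
    ∣ X ∣ + ∣ X ∩ EIn G b (∁ Z) ∣          ≡⟨ handshake X ⟩
    outerDeg X + ∣ X ∩ EIn G b Z ∣         ≡⟨ cong₂ _+_ (sum-cong-≗ saturated-all) all-inner ⟩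
    outerB + ∣ EIn G b Z ∣ ∎
    where
    open ≡-Reasoning
    open Tight T
    no-outer : ∀ e → 𝟙 (lookup X e ∧ (out (end₁ G e) ∧ out (end₂ G e))) ≡ 0
    no-outer e with lookup X e in x | lookup Z (end₁ G e) in z₁ | lookup Z (end₂ G e) in z₂
    ... | true | false | false = ⊥-elim (outer-out e x z₁ z₂)
    ... | true | true | _ = refl
    ... | true | false | true = refl
    ... | false | _ | _ = refl
    saturated-all : ∀ v → (if lookup Z v then 0 else deg G X v) ≡ (if lookup Z v then 0 else b v)
    saturated-all v with lookup Z v in z
    ... | true = refl
    ... | false = saturated v z
    all-inner : ∣ X ∩ EIn G b Z ∣ ≡ ∣ EIn G b Z ∣
    all-inner = trans (inner-count X) (trans (sum-cong-≗ pointwise) (sym EIn-count))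
      where
      pointwise : ∀ e → 𝟙 (lookup X e ∧ (lookup Z (end₁ G e) ∧ lookup Z (end₂ G e)))
                      ≡ 𝟙 (lookup Z (end₁ G e) ∧ lookup Z (end₂ G e))
      pointwise e with lookup Z (end₁ G e) in z₁ | lookup Z (end₂ G e) in z₂
      ... | true | true rewrite inner-in e z₁ z₂ = refl
      ... | true | false = cong 𝟙 (∧-zeroʳ _)
      ... | false | _ = cong 𝟙 (∧-zeroʳ _)

  size-tight : ∀ {X} → IsBMatching G b X → ∣ X ∣ ≡ outerB + ∣ EIn G b Z ∣ → Tight X
  size-tight {X} X-bm size = record { saturated = saturated ; inner-in = inner-in ; outer-out = outer-out }
    where
    outer-bounds : ∀ v → (if lookup Z v then 0 else deg G X v) ≤ (if lookup Z v then 0 else b v)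
    outer-bounds v with lookup Z v
    ... | true = z≤n
    ... | false = X-bm v
    inner-bounds : ∀ e → 𝟙 (lookup X e ∧ (lookup Z (end₁ G e) ∧ lookup Z (end₂ G e)))
                       ≤ 𝟙 (lookup Z (end₁ G e) ∧ lookup Z (end₂ G e))
    inner-bounds e with lookup X e | lookup Z (end₁ G e) ∧ lookup Z (end₂ G e)
    ... | true | c = ≤-refl
    ... | false | true = z≤n
    ... | false | false = z≤n
    inner≤ : ∣ X ∩ EIn G b Z ∣ ≤ ∣ EIn G b Z ∣
    inner≤ = subst₂ _≤_ (sym (inner-count X)) (sym EIn-count) (sum-mono-≤ inner-bounds)
    outer≡0 : ∣ X ∩ EIn G b (∁ Z) ∣ ≡ 0
    outer≡0 = n≤0⇒n≡0 (+-cancelˡ-≤ ∣ X ∣ _ _ (begin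
      ∣ X ∣ + ∣ X ∩ EIn G b (∁ Z) ∣     ≡⟨ handshake X ⟩
      outerDeg X + ∣ X ∩ EIn G b Z ∣    ≤⟨ +-mono-≤ (sum-mono-≤ outer-bounds) inner≤ ⟩
      outerB + ∣ EIn G b Z ∣            ≡⟨ size ⟨
      ∣ X ∣                             ≡⟨ +-identityʳ _ ⟨
      ∣ X ∣ + 0                         ∎))
      where open ℕₚ.≤-Reasoning
    both : outerDeg X ≡ outerB × ∣ X ∩ EIn G b Z ∣ ≡ ∣ EIn G b Z ∣
    both = +-≤-tight (sum-mono-≤ outer-bounds) inner≤
      (trans (sym (handshake X)) (trans (cong (∣ X ∣ +_) outer≡0) (trans (+-identityʳ _) size)))
    saturated : ∀ v → lookup Z v ≡ false → deg G X v ≡ b v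
    saturated v z = subst (λ t → (if t then 0 else deg G X v) ≡ (if t then 0 else b v)) z
      (sum-tight outer-bounds (proj₁ both) v)
    inner-in : ∀ e → lookup Z (end₁ G e) ≡ true → lookup Z (end₂ G e) ≡ true → lookup X e ≡ true
    inner-in e z₁ z₂ = 𝟙≡1 (trans (cong 𝟙 (sym (∧-identityʳ _)))
      (subst₂ (λ p q → 𝟙 (lookup X e ∧ (p ∧ q)) ≡ 𝟙 (p ∧ q)) z₁ z₂
        (sum-tight inner-bounds (trans (sym (inner-count X)) (trans (proj₂ both) EIn-count)) e)))
    outer-out : ∀ e → lookup X e ≡ true → lookup Z (end₁ G e) ≡ false → lookup Z (end₂ G e) ≡ false → ⊥
    outer-out e x z₁ z₂ = <-irrefl refl (subst (_≤ 0) counted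
      (≤-trans (term≤sum _ e) (≤-reflexive (trans (sym (outer-count X)) outer≡0))))
      where
      counted : 𝟙 (lookup X e ∧ (out (end₁ G e) ∧ out (end₂ G e))) ≡ 1
      counted rewrite x | z₁ | z₂ = refl

module Theorem (G : Graph) (inA : Fin (nV G) → Bool) (bip : ∀ e → inA (end₁ G e) ≢ inA (end₂ G e))
               (b : Fin (nV G) → ℕ) (M : Subset (nE G)) (maxM : IsMaxBMatching G b M) where

  open Incidence G
  open Paths G
  open Alternation G M
  open Colours inA bip
  open SymmetricDifference G
  open PathSearch G

  𝒰 𝒮 𝒯 : V → Set
  𝒰 = UA G b inA M
  𝒮 = SA G b inA M
  𝒯 = TA G b inA M

  M-bm : IsBMatching G b M
  M-bm = proj₁ maxM

  maximum-of-size : ∀ M′ → IsBMatching G b M′ → ∣ M′ ∣ ≡ ∣ M ∣ → IsMaxBMatching G b M′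
  maximum-of-size M′ bm′ eq = bm′ , λ M″ bm″ → subst (∣ M″ ∣ ≤_) (sym eq) (proj₂ maxM M″ bm″)

  colour-across : ∀ {e a w} → Joins G e a w → inA w ≡ not (inA a)
  colour-across j = ¬-not (joins-colours j ∘ sym)

  𝒮-path : ∀ {x} → 𝒮 x → ∃ λ L → ∃ λ (Q : IPath L) → first Q ≡ x × 𝒰 (last Q) × IsWedge Q
  𝒮-path (_ , P , u , u∈U , wedge) with wedge-of P wedge
  ... | s , refl , w = len P , ofPath P , s , u∈U , w

  𝒮-of-path : ∀ {L} (Q : IPath L) → IsWedge Q → 𝒰 (last Q) → inA (first Q) ≡ true → 𝒮 (first Q)
  𝒮-of-path Q w u∈U a = a , asPath Q , last Q , u∈U , as-wedge Q w

  𝒯-path : ∀ {y} → 𝒯 y → ∃ λ L → ∃ λ (Q : IPath L) → first Q ≡ y × 𝒰 (last Q) × IsExposed Q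
  𝒯-path (_ , P , u , u∈U , exposed) with exposed-of P exposed
  ... | L , Q , s , refl , x = L , Q , s , u∈U , x

  𝒯-of-path : ∀ {L} (Q : IPath L) → IsExposed Q → 𝒰 (last Q) → inA (first Q) ≡ false → 𝒯 (first Q)
  𝒯-of-path Q x u∈U a = a , asPath Q , last Q , u∈U , as-exposed Q x

  loose-at : ∀ u → Loose G b M u → ∀ v → deg G M v + 𝟙 (u == v) ≤ b v
  loose-at u u-loose v with u ≟ v
  ... | yes refl = subst (_≤ b v) (+-comm 1 _) u-loose
  ... | no _ = subst (_≤ b v) (sym (+-identityʳ _)) (M-bm v)

  switch-bm : ∀ {L} (Q : IPath L) → (∀ v → On Q v → deg G (switch Q) v ≤ b v) → IsBMatching G b (switch Q)
  switch-bm Q on-path v with On? Q v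
  ... | yes o = on-path v o
  ... | no v∉Q = subst (_≤ b v) (sym (switch-deg-off Q v v∉Q)) (M-bm v)

  -- S_A ⊆ 𝒟: switching along a wedge from x to a loose vertex gives a
  -- maximum b-matching in which x is loose.
  𝒮⊆𝒟 : ∀ {x} → 𝒮 x → D G b x
  𝒮⊆𝒟 s with 𝒮-path s
  ... | zero , Q , refl , u∈U , w = M , maxM , proj₂ u∈U
  ... | suc L , Q , refl , u∈U , w =
    switch Q , maximum-of-size (switch Q) (switch-bm Q bounded) (wedge-switch-card Q w) , first-loose
    where
    bounded : ∀ v → On Q v → deg G (switch Q) v ≤ b v
    bounded v o = ≤-trans (m≤m+n _ _)
      (≤-trans (≤-reflexive (wedge-switch-deg Q w v o)) (loose-at (last Q) (proj₂ u∈U) v))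
    first-loose : Loose G b (switch Q) (first Q)
    first-loose = subst (_≤ b (first Q)) (begin
      deg G M (first Q)                                      ≡⟨ +-identityʳ _ ⟨
      deg G M (first Q) + 0                                  ≡⟨ cong (λ z → deg G M (first Q) + 𝟙 z) (==-false (last≢first Q)) ⟨
      deg G M (first Q) + 𝟙 (last Q == first Q)              ≡⟨ wedge-switch-deg Q w (first Q) (zero , refl) ⟨
      deg G (switch Q) (first Q) + 𝟙 (first Q == first Q)   ≡⟨ cong (λ z → deg G (switch Q) (first Q) + 𝟙 z) (==-refl (first Q)) ⟩
      deg G (switch Q) (first Q) + 1                         ≡⟨ +-comm _ 1 ⟩
      suc (deg G (switch Q) (first Q)) ∎) (M-bm (first Q))
      where open ≡-Reasoning

  -- No vertex of T_A is loose: an exposed path between two loose vertices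
  -- would augment M.
  𝒯-saturated : ∀ {y} → 𝒯 y → ¬ Loose G b M y
  𝒯-saturated t y-loose with 𝒯-path t
  ... | zero , Q , _ , _ , x = exposed-nontrivial Q x
  ... | suc L , Q , refl , u∈U , x =
    <-irrefl refl (≤-trans (≤-reflexive (sym (exposed-switch-card Q x))) (proj₂ maxM (switch Q) (switch-bm Q bounded)))
    where
    bounded : ∀ v → On Q v → deg G (switch Q) v ≤ b v
    bounded v o rewrite exposed-switch-deg Q x v o with first Q ≟ v
    ... | yes refl rewrite ==-false (last≢first Q) | +-identityʳ (deg G M v) = subst (_≤ b v) (+-comm 1 _) y-loose
    ... | no _ = subst (_≤ b v) (sym (+-identityʳ _)) (loose-at (last Q) (proj₂ u∈U) v)

  Reached : V → Set
  Reached v = (inA v ≡ true → 𝒮 v) × (inA v ≡ false → 𝒯 v)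

  -- Every vertex of a wedge or exposed path ending in U_A is reached: its
  -- suffix is again a wedge or an exposed path.
  mutual
    wedge-reaches : ∀ {L} (Q : IPath L) → IsWedge Q → 𝒰 (last Q) → ∀ v → On Q v → Reached v
    wedge-reaches Q w u∈U v (zero , refl) =
      𝒮-of-path Q w u∈U , λ a → ⊥-elim (true≢false (trans (sym (proj₁ u∈U)) (trans (sym (wedge-colour Q w)) a)))
    wedge-reaches {suc L} Q w u∈U v (suc j , e) = exposed-reaches (tail Q) (proj₂ (wedge-step Q w)) u∈U v (j , e)

    exposed-reaches : ∀ {L} (Q : IPath L) → IsExposed Q → 𝒰 (last Q) → ∀ v → On Q v → Reached v
    exposed-reaches {zero} Q x = ⊥-elim (exposed-nontrivial Q x)
    exposed-reaches {suc L} Q x u∈U v (zero , refl) =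
      (λ a → ⊥-elim (exposed-colour Q x (trans a (sym (proj₁ u∈U))))) , 𝒯-of-path Q x u∈U
    exposed-reaches {suc L} Q x u∈U v (suc j , e) = wedge-reaches (tail Q) (proj₂ (exposed-step Q x)) u∈U v (j , e)

  loose-𝒮 : ∀ v → inA v ≡ true → Loose G b M v → 𝒮 v
  loose-𝒮 v a v-loose = 𝒮-of-path (trivial v) (λ { v′ (zero , refl) → cong 𝟙 (==-refl v) }) (a , v-loose) a

  -- S_A is closed under non-M edges into T_A, and T_A under M-edges into S_A:
  -- prepend the edge to the path, unless its new end already lies on it.
  𝒮-step : ∀ {f x y} → 𝒮 x → Joins G f x y → lookup M f ≡ false → 𝒯 y
  𝒮-step {f} {x} {y} s j f∉M with 𝒮-path s
  ... | L , Q , refl , u∈U , w with On? Q y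
  ... | yes o = proj₂ (wedge-reaches Q w u∈U y o) y∈B
    where y∈B = trans (colour-across j) (cong not (proj₁ s))
  ... | no y∉Q = 𝒯-of-path Q′ exposed u∈U (trans (colour-across j) (cong not (proj₁ s)))
    where
    Q′ = cons Q y f y∉Q (joins-sym j)
    exposed : IsExposed Q′
    exposed v o with on-cons Q y f y∉Q (joins-sym j) o
    ... | inj₁ refl rewrite incident-joins y (joins-sym j) | ==-refl y | f∉M
                          | count-off Q y (not ∘ lookup M) y∉Q = refl
    ... | inj₂ o′ rewrite incident-joins v (joins-sym j) | ==-false {y} {v} (λ e → y∉Q (subst (On Q) (sym e) o′)) | f∉M
                        | ∧-identityʳ (first Q == v) = trans (+-comm _ (atN Q v)) (wedge-atN Q w v o′)

  𝒯-step : ∀ {f y z} → 𝒯 y → Joins G f y z → lookup M f ≡ true → 𝒮 z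
  𝒯-step {f} {y} {z} t j f∈M with 𝒯-path t
  ... | L , Q , refl , u∈U , x with On? Q z
  ... | yes o = proj₁ (exposed-reaches Q x u∈U z o) z∈A
    where z∈A = trans (colour-across j) (cong not (proj₁ t))
  ... | no z∉Q = 𝒮-of-path Q′ wedge u∈U (trans (colour-across j) (cong not (proj₁ t)))
    where
    Q′ = cons Q z f z∉Q (joins-sym j)
    wedge : IsWedge Q′
    wedge v o with on-cons Q z f z∉Q (joins-sym j) o
    ... | inj₁ refl rewrite incident-joins z (joins-sym j) | ==-refl z | f∈M
                          | count-off Q z (lookup M) z∉Q | ==-false {last Q} {z} (λ e → z∉Q (_ , e)) = refl
    ... | inj₂ o′ rewrite incident-joins v (joins-sym j) | ==-false {z} {v} (λ e → z∉Q (subst (On Q) (sym e) o′)) | f∈M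
                        | ∧-identityʳ (first Q == v) = trans (regroup (𝟙 (first Q == v)) (atM Q v) (𝟙 (last Q == v))) (exposed-atM Q x v o′)
      where
      regroup : ∀ a c d → a + c + d ≡ c + d + a
      regroup = solve-∀

  WedgeFrom : V → ∀ {L} → IPath L → Set
  WedgeFrom x Q = first Q ≡ x × 𝒰 (last Q) × IsWedge Q

  wedgeFrom-respects : ∀ x → Respects (WedgeFrom x)
  wedgeFrom-respects x {L} Q Q′ hv he (s , u∈U , w) =
    trans (sym (hv zero)) s , subst 𝒰 (hv (fromℕ L)) u∈U , λ v o → begin
      atM Q′ v + 𝟙 (last Q′ == v)
        ≡⟨ cong₂ _+_ (sum-cong-≗ (λ i → cong (λ e → 𝟙 (incident v e ∧ lookup M e)) (sym (he i))))
                     (cong (λ t → 𝟙 (t == v)) (sym (hv (fromℕ L)))) ⟩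
      atM Q v + 𝟙 (last Q == v)
        ≡⟨ w v (on-transport o) ⟩
      1 ∎
    where
    open ≡-Reasoning
    on-transport : ∀ {v} → On Q′ v → On Q v
    on-transport (i , e) = i , trans (hv i) e

  wedgeFrom? : ∀ x {L} (Q : IPath L) → Dec (WedgeFrom x Q)
  wedgeFrom? x Q = (first Q ≟ x) ×-dec ((inA (last Q) Boolₚ.≟ true) ×-dec (deg G M (last Q) <? b (last Q)))
                   ×-dec all? (λ v → On? Q v →-dec (atM Q v + 𝟙 (last Q == v) ℕₚ.≟ 1))

  𝒮? : ∀ x → Dec (𝒮 x)
  𝒮? x with inA x Boolₚ.≟ true | path-search (WedgeFrom x) (wedgeFrom-respects x) (wedgeFrom? x)
  ... | no x∉A | _ = no (x∉A ∘ proj₁)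
  ... | yes x∈A | yes (L , Q , refl , u∈U , w) = yes (𝒮-of-path Q w u∈U x∈A)
  ... | yes _ | no none = no (none ∘ 𝒮-path)

  second-in-𝒮 : ∀ {L} (Q : IPath (suc L)) → IsExposed Q → 𝒰 (last Q) → inA (first Q) ≡ false →
    𝒮 (vt Q (suc zero))
  second-in-𝒮 Q x u∈U y∈B =
    proj₁ (exposed-reaches Q x u∈U _ (suc zero , refl)) (trans (colour-across (ed-joins Q zero)) (cong not y∈B))

  𝒮-neighbour : V → E → Set
  𝒮-neighbour y f = lookup M f ≡ false × ((end₁ G f ≡ y × 𝒮 (end₂ G f)) ⊎ (end₂ G f ≡ y × 𝒮 (end₁ G f)))

  𝒯-neighbour : ∀ {y} → 𝒯 y → ∃ (𝒮-neighbour y)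
  𝒯-neighbour t with 𝒯-path t
  ... | zero , Q , _ , _ , x = ⊥-elim (exposed-nontrivial Q x)
  ... | suc L , Q , refl , u∈U , x = ed Q zero , proj₁ (exposed-step Q x) , ends (ed-joins Q zero)
    where
    second = vt Q (suc zero)
    second∈𝒮 : 𝒮 second
    second∈𝒮 = proj₁ (exposed-reaches Q x u∈U second (suc zero , refl))
                     (trans (colour-across (ed-joins Q zero)) (cong not (proj₁ t)))
    ends : Joins G (ed Q zero) (first Q) second →
      (end₁ G (ed Q zero) ≡ first Q × 𝒮 (end₂ G (ed Q zero))) ⊎ (end₂ G (ed Q zero) ≡ first Q × 𝒮 (end₁ G (ed Q zero)))
    ends (inj₁ (p , q)) = inj₁ (p , subst 𝒮 (sym q) second∈𝒮)
    ends (inj₂ (p , q)) = inj₂ (q , subst 𝒮 (sym p) second∈𝒮)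

  neighbour-𝒯 : ∀ {y f} → 𝒮-neighbour y f → 𝒯 y
  neighbour-𝒯 (f∉M , inj₁ (p , s)) = 𝒮-step s (inj₂ (p , refl)) f∉M
  neighbour-𝒯 (f∉M , inj₂ (p , s)) = 𝒮-step s (inj₁ (refl , p)) f∉M

  𝒯? : ∀ y → Dec (𝒯 y)
  𝒯? y = map′ (neighbour-𝒯 ∘ proj₂) 𝒯-neighbour (any? λ f → (lookup M f Boolₚ.≟ false) ×-dec
           (((end₁ G f ≟ y) ×-dec 𝒮? (end₂ G f)) ⊎-dec ((end₂ G f ≟ y) ×-dec 𝒮? (end₁ G f))))

  InZ : V → Set
  InZ v = 𝒮 v ⊎ (inA v ≡ false × ¬ 𝒯 v)

  InZ? : ∀ v → Dec (InZ v)
  InZ? v = 𝒮? v ⊎-dec ((inA v Boolₚ.≟ false) ×-dec ¬? (𝒯? v))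

  Z₀ : Subset (nV G)
  Z₀ = tabulate (λ v → ⌊ InZ? v ⌋)

  Z₀-spec : ∀ v → (v ∈ Z₀) ⇔ InZ v
  Z₀-spec v = mk⇔ (λ h → ⌊⌋-true⁻ (InZ? v) (trans (sym (lookup∘tabulate _ v)) (∈⇒lookup h)))
                  (λ z → lookup⇒∈ (trans (lookup∘tabulate _ v) (⌊⌋-true (InZ? v) z)))

  loopless : ∀ e → end₁ G e ≢ end₂ G e
  loopless e eq = bip e (cong inA eq)

  joins-ends : ∀ e → Joins G e (end₁ G e) (end₂ G e)
  joins-ends e = inj₁ (refl , refl)

  -- Part (i): for Z = S_A ∪ (B ∖ T_A), M is tight, so Z is b-verifying and
  -- every maximum b-matching is tight for Z as well.
  module PartI (Z : Subset (nV G)) (Z-spec : ∀ v → (v ∈ Z) ⇔ InZ v) where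

    open Duality G b loopless Z public

    in-Z : ∀ {v} → lookup Z v ≡ true → InZ v
    in-Z h = Equivalence.to (Z-spec _) (lookup⇒∈ h)

    out-Z : ∀ {v} → lookup Z v ≡ false → ¬ InZ v
    out-Z h z = true≢false (trans (sym (∈⇒lookup (Equivalence.from (Z-spec _) z))) h)

    in-Z-A : ∀ {v} → lookup Z v ≡ true → inA v ≡ true → 𝒮 v
    in-Z-A h a with in-Z h
    ... | inj₁ s = s
    ... | inj₂ (a′ , _) = ⊥-elim (true≢false (trans (sym a) a′))

    in-Z-B : ∀ {v} → lookup Z v ≡ true → inA v ≡ false → ¬ 𝒯 v
    in-Z-B h a t with in-Z h
    ... | inj₁ s = true≢false (trans (sym (proj₁ s)) a)
    ... | inj₂ (_ , ¬t) = ¬t t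

    -- Vertices outside Z are saturated: a loose vertex of A is in S_A and a
    -- loose vertex of B is not in T_A.
    saturated : ∀ v → lookup Z v ≡ false → deg G M v ≡ b v
    saturated v z with deg G M v <? b v
    ... | no ¬loose = ≤-antisym (M-bm v) (≮⇒≥ ¬loose)
    ... | yes loose with inA v in a
    ...   | true = ⊥-elim (out-Z z (inj₁ (loose-𝒮 v a loose)))
    ...   | false = ⊥-elim (out-Z z (inj₂ (a , λ t → 𝒯-saturated t loose)))

    -- An M-edge from T_A leads into S_A, so no M-edge leaves Z at both ends.
    outer-out : ∀ e → lookup M e ≡ true → lookup Z (end₁ G e) ≡ false → lookup Z (end₂ G e) ≡ false → ⊥
    outer-out e e∈M z₁ z₂ with inA (end₁ G e) in a
    ... | true = out-Z z₂ (inj₂ (trans (colour-across (joins-ends e)) (cong not a) ,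
                   λ t → out-Z z₁ (inj₁ (𝒯-step t (joins-sym (joins-ends e)) e∈M))))
    ... | false = out-Z z₁ (inj₂ (a , λ t → out-Z z₂ (inj₁ (𝒯-step t (joins-ends e) e∈M))))

    -- A non-M edge from S_A leads into T_A, so every edge inside Z is in M.
    inner-in : ∀ e → lookup Z (end₁ G e) ≡ true → lookup Z (end₂ G e) ≡ true → lookup M e ≡ true
    inner-in e z₁ z₂ with lookup M e in e∈M
    ... | true = refl
    ... | false with inA (end₁ G e) in a
    ...   | true = ⊥-elim (in-Z-B z₂ (trans (colour-across (joins-ends e)) (cong not a))
                     (𝒮-step (in-Z-A z₁ a) (joins-ends e) e∈M))
    ...   | false = ⊥-elim (in-Z-B z₁ a
                     (𝒮-step (in-Z-A z₂ (trans (colour-across (joins-ends e)) (cong not a))) (joins-sym (joins-ends e)) e∈M))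

    M-tight : Tight M
    M-tight = record { saturated = saturated ; inner-in = inner-in ; outer-out = outer-out }

    b-verifying : BVerifying G b Z
    b-verifying = M , maxM , trans (cong (_+ ∣ EIn G b Z ∣) outerB-bsum) (sym (tight-size M-tight))

    maximum-tight : ∀ M′ → IsMaxBMatching G b M′ → Tight M′
    maximum-tight M′ (bm′ , max′) =
      size-tight bm′ (trans (≤-antisym (proj₂ maxM M′ bm′) (max′ M M-bm)) (tight-size M-tight))

  open PartI Z₀ Z₀-spec using (maximum-tight)

  Z₀-true : ∀ {v} → InZ v → lookup Z₀ v ≡ true
  Z₀-true {v} z = trans (lookup∘tabulate _ v) (⌊⌋-true (InZ? v) z)

  Z₀-false : ∀ {v} → ¬ InZ v → lookup Z₀ v ≡ false
  Z₀-false {v} ¬z = trans (lookup∘tabulate _ v) (⌊⌋-false (InZ? v) ¬z)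

  -- Part (ii): a vertex of A loose in some maximum b-matching M′ lies in
  -- S_A, since otherwise it is outside Z₀ and M′ saturates it.
  𝒮⇔𝒟∩A : ∀ v → 𝒮 v ⇔ (D G b v × inA v ≡ true)
  𝒮⇔𝒟∩A v = mk⇔ (λ s → 𝒮⊆𝒟 s , proj₁ s) from
    where
    from : D G b v × inA v ≡ true → 𝒮 v
    from ((M′ , max′ , loose′) , a) with 𝒮? v
    ... | yes s = s
    ... | no ¬s = ⊥-elim (<-irrefl (Duality.Tight.saturated (maximum-tight M′ max′) v (Z₀-false ¬InZ)) loose′)
      where
      ¬InZ : ¬ InZ v
      ¬InZ (inj₁ s) = ¬s s
      ¬InZ (inj₂ (a′ , _)) = true≢false (trans (sym a) a′)

  -- Flexible edges do not leave S_A ∪ T_A: a flexible edge from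
  -- S_A to outside T_A would lie inside Z₀ yet avoid some maximum b-matching,
  -- and one from T_A to outside S_A would be an edge of a maximum b-matching
  -- with both ends outside Z₀.
  at-ends : ∀ {e a c} (P : V → Set) → Joins G e a c → P a → P c → P (end₁ G e) × P (end₂ G e)
  at-ends P (inj₁ (p , q)) pa pc = subst P (sym p) pa , subst P (sym q) pc
  at-ends P (inj₂ (p , q)) pa pc = subst P (sym p) pc , subst P (sym q) pa

  flexible-step : ∀ {a c} → 𝒮 a ⊎ 𝒯 a → FlexAdj G b a c → 𝒮 c ⊎ 𝒯 c
  flexible-step {a} {c} (inj₁ s) (e , (_ , (M″ , max″ , e∉M″)) , j) with 𝒯? c
  ... | yes t = inj₂ t
  ... | no ¬t = ⊥-elim (e∉M″ (lookup⇒∈ (Duality.Tight.inner-in (maximum-tight M″ max″) e (proj₁ ends) (proj₂ ends))))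
    where
    c∈B = trans (colour-across j) (cong not (proj₁ s))
    ends = at-ends (λ v → lookup Z₀ v ≡ true) j (Z₀-true (inj₁ s)) (Z₀-true (inj₂ (c∈B , ¬t)))
  flexible-step {a} {c} (inj₂ t) (e , ((M′ , max′ , e∈M′) , _) , j) with 𝒮? c
  ... | yes s = inj₁ s
  ... | no ¬s = ⊥-elim (Duality.Tight.outer-out (maximum-tight M′ max′) e (∈⇒lookup e∈M′) (proj₁ ends) (proj₂ ends))
    where
    c∈A = trans (colour-across j) (cong not (proj₁ t))
    a∉Z : ¬ InZ a
    a∉Z (inj₁ s) = true≢false (trans (sym (proj₁ s)) (proj₁ t))
    a∉Z (inj₂ (_ , ¬t)) = ¬t t
    c∉Z : ¬ InZ c
    c∉Z (inj₁ s) = ¬s s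
    c∉Z (inj₂ (c∈B , _)) = true≢false (trans (sym c∈A) c∈B)
    ends = at-ends (λ v → lookup Z₀ v ≡ false) j (Z₀-false a∉Z) (Z₀-false c∉Z)

  flexible-closed : ∀ {a c} → FlexConn G b a c → 𝒮 a ⊎ 𝒯 a → 𝒮 c ⊎ 𝒯 c
  flexible-closed ε r = r
  flexible-closed (step ◅ steps) r = flexible-closed steps (flexible-step r step)

  flexible-sym : ∀ {a c} → FlexAdj G b a c → FlexAdj G b c a
  flexible-sym (e , flexible , j) = e , flexible , joins-sym j

  inactive-isolated : ∀ X {e v w} → b v ≡ 0 → IsBMatching G b X → lookup X e ≡ true → Joins G e v w → ⊥
  inactive-isolated X {v = v} b≡0 X-bm Xe j =
    <-irrefl refl (≤-trans (member-deg X Xe j) (subst (deg G X v ≤_) b≡0 (X-bm v)))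


  -- Let Q be an exposed path from an active vertex y ∈ T_A to U_A.  As y is
  -- saturated with b y > 0, some M-edge g meets y, and g is off Q.  Switching
  -- M along Q and dropping g gives a maximum b-matching containing the first
  -- edge e₀ of Q, while e₀ ∉ M: so e₀ is flexible.
  exposed-first-flexible : ∀ {L} (Q : IPath (suc L)) → IsExposed Q → 𝒰 (last Q) →
    b (first Q) ≢ 0 → ¬ Loose G b M (first Q) → Flexible G b (ed Q zero)
  exposed-first-flexible Q x u∈U active y-saturated =
    (M₂ , maximum-of-size M₂ M₂-bm M₂-size , lookup⇒∈ e₀∈M₂) ,
    (M , maxM , λ h → true≢false (trans (sym (∈⇒lookup h)) e₀∉M))
    where
    y = first Q
    e₀ = ed Q zero
    e₀∉M : lookup M e₀ ≡ false
    e₀∉M = proj₁ (exposed-step Q x)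

    y-full : deg G M y ≡ b y
    y-full = ≤-antisym (M-bm y) (≮⇒≥ y-saturated)

    g-at-y : ∃ λ g → lookup M g ≡ true × incident y g ≡ true
    g-at-y = edge-at M y (subst (0 <_) (sym y-full) (n≢0⇒n>0 active))
    g = proj₁ g-at-y
    g∈M = proj₁ (proj₂ g-at-y)
    y∈g = proj₂ (proj₂ g-at-y)

    M₁ = switch Q
    g∈M₁ : lookup M₁ g ≡ true
    g∈M₁ = trans (lookup-⊕ M (pathEdges G (asPath Q)) g) (cong₂ _xor_ g∈M (exposed-first-M-off Q x g∈M y∈g))

    M₂ = without M₁ g
    M₂-size : ∣ M₂ ∣ ≡ ∣ M ∣
    M₂-size = +-cancelʳ-≡ 1 _ _ (trans (card-without M₁ g g∈M₁) (trans (exposed-switch-card Q x) (+-comm 1 _)))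

    M₁-deg : ∀ v → y ≢ v → deg G M₁ v ≤ b v
    M₁-deg v y≢v with On? Q v
    ... | no v∉Q = subst (_≤ b v) (sym (switch-deg-off Q v v∉Q)) (M-bm v)
    ... | yes o rewrite exposed-switch-deg Q x v o | ==-false y≢v | +-identityʳ (deg G M v + 𝟙 (last Q == v)) =
      loose-at (last Q) (proj₂ u∈U) v

    M₂-bm : IsBMatching G b M₂
    M₂-bm v with y ≟ v
    ... | no y≢v = ≤-trans (≤-trans (m≤m+n _ _) (≤-reflexive (deg-without M₁ g v g∈M₁))) (M₁-deg v y≢v)
    ... | yes refl = ≤-reflexive (+-cancelʳ-≡ 1 _ _ (begin
      deg G M₂ y + 1                        ≡⟨ cong (λ z → deg G M₂ y + 𝟙 z) y∈g ⟨
      deg G M₂ y + 𝟙 (incident y g)         ≡⟨ deg-without M₁ g y g∈M₁ ⟩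
      deg G M₁ y                            ≡⟨ exposed-switch-deg Q x y (zero , refl) ⟩
      deg G M y + 𝟙 (last Q == y) + 𝟙 (y == y) ≡⟨ cong₂ (λ p q → deg G M y + 𝟙 p + 𝟙 q) (==-false (last≢first Q)) (==-refl y) ⟩
      deg G M y + 0 + 1                     ≡⟨ cong (λ z → z + 0 + 1) y-full ⟩
      b y + 0 + 1                           ≡⟨ cong (_+ 1) (+-identityʳ (b y)) ⟩
      b y + 1 ∎))
      where open ≡-Reasoning

    e₀∈M₂ : lookup M₂ e₀ ≡ true
    e₀∈M₂ = trans (lookup-without M₁ λ e₀≡g → true≢false (trans (sym g∈M) (trans (cong (lookup M) (sym e₀≡g)) e₀∉M)))
                  (exposed-first-switched Q x)

  Hooked : V → Set
  Hooked u = ∃ λ v → FlexConn G b v u × InconsistentHookedUp G b inA v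

  -- A vertex y of T_A is hooked up through the second vertex w ∈ S_A ⊆ 𝒟 ∩ A
  -- of an exposed path from y: either y is inactive and adjacent to w, or
  -- the first edge is flexible and joins the flexible component of y to w.
  𝒯-hooked : ∀ {y} → 𝒯 y → Hooked y
  𝒯-hooked t with 𝒯-path t
  ... | zero , Q , _ , _ , x = ⊥-elim (exposed-nontrivial Q x)
  ... | suc L , Q , refl , u∈U , x with b (first Q) ℕₚ.≟ 0
  ...   | yes inactive = first Q , ε , inj₂ (inactive , w , (ed Q zero , ed-joins Q zero) , w∈𝒟 , proj₁ w∈𝒮)
    where
    w = vt Q (suc zero)
    w∈𝒮 = second-in-𝒮 Q x u∈U (proj₁ t)
    w∈𝒟 = 𝒮⊆𝒟 w∈𝒮
  ...   | no active = first Q , ε , inj₁ ((w , first-edge ◅ ε , w∈𝒟) , (w , first-edge ◅ ε , w∈𝒟 , proj₁ w∈𝒮))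
    where
    w = vt Q (suc zero)
    w∈𝒮 = second-in-𝒮 Q x u∈U (proj₁ t)
    w∈𝒟 = 𝒮⊆𝒟 w∈𝒮
    first-edge : FlexAdj G b (first Q) w
    first-edge = ed Q zero , exposed-first-flexible Q x u∈U active (𝒯-saturated t) , ed-joins Q zero

  -- Conversely, hooked vertices are reached from S_A along flexible edges,
  -- or are inactive neighbours of S_A (joined by a non-M edge).
  hooked-reached : ∀ {u} → Hooked u → 𝒮 u ⊎ 𝒯 u
  hooked-reached (v , v⇝u , inj₁ (_ , (w , v⇝w , w∈𝒟 , w∈A))) =
    flexible-closed (Star.reverse flexible-sym v⇝w ◅◅ v⇝u) (inj₁ (Equivalence.from (𝒮⇔𝒟∩A w) (w∈𝒟 , w∈A)))
  hooked-reached (v , ε , inj₂ (inactive , w , (e , j) , w∈𝒟 , w∈A)) =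
    inj₂ (𝒮-step (Equivalence.from (𝒮⇔𝒟∩A w) (w∈𝒟 , w∈A)) (joins-sym j) e∉M)
    where
    e∉M : lookup M e ≡ false
    e∉M with lookup M e in e∈M
    ... | false = refl
    ... | true = ⊥-elim (inactive-isolated M inactive M-bm e∈M j)
  hooked-reached (v , (e , ((M′ , max′ , e∈M′) , _) , j) ◅ _ , inj₂ (inactive , _)) =
    ⊥-elim (inactive-isolated M′ inactive (proj₁ max′) (∈⇒lookup e∈M′) j)

  𝒮∪𝒯⇔hooked : ∀ u → (𝒮 u ⊎ 𝒯 u) ⇔ Hooked u
  𝒮∪𝒯⇔hooked u = mk⇔ to hooked-reached
    where
    to : 𝒮 u ⊎ 𝒯 u → Hooked u
    to (inj₁ s) = u , ε , inj₁ ((u , ε , 𝒮⊆𝒟 s) , (u , ε , 𝒮⊆𝒟 s , proj₁ s))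
    to (inj₂ t) = 𝒯-hooked t


mainTheorem12 : (G : Graph) (inA : Fin (nV G) → Bool)
    → (∀ e → inA (end₁ G e) ≢ inA (end₂ G e))
    → (b : Fin (nV G) → ℕ) (M : Subset (nE G))
    → IsMaxBMatching G b M
    → ((Z : Subset (nV G))
         → (∀ v → (v ∈ Z) ⇔ (SA G b inA M v ⊎ (inA v ≡ false × ¬ TA G b inA M v)))
         → BVerifying G b Z)
      × (∀ v → SA G b inA M v ⇔ (D G b v × inA v ≡ true))
      × (∀ u → (SA G b inA M u ⊎ TA G b inA M u)
               ⇔ ∃ λ v → FlexConn G b v u × InconsistentHookedUp G b inA v)
mainTheorem12 G inA bip b M maxM =
  (λ Z Z-spec → PartI.b-verifying Z Z-spec) , 𝒮⇔𝒟∩A , 𝒮∪𝒯⇔hooked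
  where open Theorem G inA bip b M maxM
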